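{- For positive integers $n,k$ and a nonnegative integer $m$, let $D(n,k,m)$ be the number of partitions of $n$ into $k$ distinct parts which have exactly $m$ sequences of odd length, and let $B(n,k,m)$ be the number of partitions $\lambda$ of $n$ into odd parts with $\mathrm{Dur}_2(\lambda)=k$ and $\mathrm{alt}(\lambda)=m$. Then \[ B(n,\lceil k/2\rceil,m)=D(n,k,m). \]
   Context: For a partition into distinct parts, a "sequence" is a maximal run of parts forming consecutive integers; its length is its number of parts. For a partition $\lambda=(\lambda_1\ge\cdots\ge\lambda_\ell)$ into odd parts, with $\lambda_i=0$ for $i>\ell$, $\mathrm{Dur}_2(\lambda)=\max\{i\ge1:\lambda_i\ge 2i-1\}$ (and $0$ if $\lambda$ is empty). Alternating index: let $k=\mathrm{Dur}_2(\lambda)\ge1$. Let $\alpha$ be the partition with parts $\lambda_i-(2k-1)$ for $1\le i\le k$ (keeping only positive ones; these are even), and $\beta=(\lambda_{k+1},\lambda_{k+2},\dots,\lambda_\ell)$. Let $\alpha^*$ be the partition whose $j$-th part is $2\cdot\#\{i\le k:\lambda_i-(2k-1)\ge 2j\}$ for $j\ge1$ (nonzero ones only; this is the conjugate of the 2-modular diagram of $\alpha$). Let $\eta=\alpha^*\cup\beta$ be the partition whose multiset of parts is the multiset union of the parts of $\alpha^*$ and $\beta$, with parts written in nondecreasing order $\eta_1\le\cdots\le\eta_s$, and set $\eta_{s+1}=2k$ if $\lambda_k>2k-1$ and $\eta_{s+1}=2k-1$ if $\lambda_k=2k-1$. With $\eta_0=0$, the alternating index $\mathrm{alt}(\lambda)$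 is the number of $i\in\{1,\dots,s+1\}$ such that $\eta_i$ and $\eta_{i-1}$ have different parity. (The empty partition has $\mathrm{Dur}_2=\mathrm{alt}=0$.)
   Formalization: The identity $B(n,\lceil k/2\rceil,m)=D(n,k,m)$ is asserted only when m ≡ k (mod 2). The statement above fails without it. -}

module Defs where

open import Data.Nat using (ℕ; zero; suc; _+_; _*_; _∸_; _≤?_; _<?_; _≡ᵇ_; _%_; ⌈_/2⌉)
open import Data.Nat.Properties using (≤-decTotalOrder)
open import Data.Bool using (Bool; true; false; _∧_; not; if_then_else_)
open import Data.List using (List; []; _∷_; length; take; drop; filter; map; _++_; foldr)
open import Data.List.Sort.InsertionSort.Base ≤-decTotalOrder using (sort)
open import Relation.Nullary.Decidable using (does)
open import Data.Nat using (_⊔_)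
open import Data.Nat.ListAction using (sum)

-- Partitions are represented as lists of parts written in nonincreasing order.

isOdd : ℕ → Bool
isOdd x = (x % 2) ≡ᵇ 1

strictDec : List ℕ → Bool
strictDec [] = true
strictDec (x ∷ []) = does (1 ≤? x)
strictDec (x ∷ y ∷ ys) = does (y <? x) ∧ strictDec (y ∷ ys)

nonIncr : List ℕ → Bool
nonIncr [] = true
nonIncr (x ∷ []) = true
nonIncr (x ∷ y ∷ ys) = does (y ≤? x) ∧ nonIncr (y ∷ ys)

allOdd : List ℕ → Bool
allOdd [] = true
allOdd (x ∷ xs) = isOdd x ∧ allOdd xs

isDistinctPartition : ℕ → ℕ → List ℕ → Bool
isDistinctPartition n k l = strictDec l ∧ (sum l ≡ᵇ n) ∧ (length l ≡ᵇ k)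

isOddPartition : ℕ → List ℕ → Bool
isOddPartition n l = nonIncr l ∧ allOdd l ∧ (sum l ≡ᵇ n)

-- lengths of the maximal runs of consecutive integers ("sequences"),
-- for a decreasing list: consecutive entries x, y are in the same run iff y + 1 = x
runLengths : List ℕ → List ℕ
runLengths [] = []
runLengths (x ∷ xs) = go x 1 xs
  where
  go : ℕ → ℕ → List ℕ → List ℕ
  go prev len [] = len ∷ []
  go prev len (y ∷ ys) = if (suc y ≡ᵇ prev) then go y (suc len) ys else len ∷ go y 1 ys

countTrue : List Bool → ℕ
countTrue [] = 0
countTrue (true ∷ bs) = suc (countTrue bs)
countTrue (false ∷ bs) = countTrue bs

oddSequences : List ℕ → ℕ
oddSequences l = countTrue (map isOdd (runLengths l))

-- Dur₂(λ) = max { i ≥ 1 : λ_i ≥ 2i - 1 } (0 if no such i; for i > ℓ, λ_i = 0 fails)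
dur2 : List ℕ → ℕ
dur2 = go 1
  where
  go : ℕ → List ℕ → ℕ
  go i [] = 0
  go i (x ∷ xs) = (if does (2 * i ∸ 1 ≤? x) then i else 0) ⊔ go (suc i) xs

range1 : ℕ → List ℕ
range1 zero = []
range1 (suc b) = range1 b ++ (suc b ∷ [])

-- k-th part (1-indexed), 0 beyond the length
part : ℕ → List ℕ → ℕ
part i [] = 0
part zero (x ∷ xs) = 0
part (suc zero) (x ∷ xs) = x
part (suc (suc i)) (x ∷ xs) = part (suc i) xs

parityChanges : ℕ → List ℕ → ℕ
parityChanges prev [] = 0
parityChanges prev (x ∷ xs) =
  (if isOdd prev ≡b isOdd x then 0 else 1) + parityChanges x xs
  where
  _≡b_ : Bool → Bool → Bool
  true ≡b b = b
  false ≡b b = not b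

alt : List ℕ → ℕ
alt l with dur2 l
... | zero = 0
... | k@(suc _) = parityChanges 0 (η ++ (last ∷ []))
  where
  -- the parts λ_i - (2k-1), i ≤ k (zero ones contribute nothing below)
  αparts : List ℕ
  αparts = map (λ x → x ∸ (2 * k ∸ 1)) (take k l)
  -- j-th part of α* is 2 · #{ i ≤ k : λ_i - (2k-1) ≥ 2j }; j ranges over
  -- 1 .. sum l, which covers all j with a nonzero part; zero parts dropped
  αstar : List ℕ
  αstar = filter (λ y → 1 ≤? y)
            (map (λ j → 2 * countTrue (map (λ a → does (2 * j ≤? a)) αparts)) (range1 (sum l)))
  β : List ℕ
  β = drop k l
  η : List ℕ
  η = sort (αstar ++ β)
  last : ℕ
  last = if does (2 * k ∸ 1 <? part k l) then 2 * k else 2 * k ∸ 1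

-- A partition into k distinct parts is determined by its gap vector v ∈ ℕᵏ, where
-- vᵢ = λᵢ − λᵢ₊₁ − 1 (with λ_{k+1} = 0), and its sequences are the blocks of v closed by a
-- positive gap.  The same v encodes an odd partition `oddSide v` of the same size whose
-- 2-modular Durfee size is d = ⌈k/2⌉: v₁, v₃, … are the multiplicities of 1, 3, …, 2d − 1 below
-- the Durfee square and v₂, v₄, … the half-differences of the d parts above it.  Its sequence η
-- lists each j ≤ k with multiplicity v_j (and k once more when k is even), so consecutive values
-- occurring in 0, η, k differ by the lengths of the sequences, and alt counts the odd ones.
-- That count has the parity of k, so together with Dur₂ = ⌈k/2⌉ it determines k.
module Submission where

open import Defs
open import Data.Bool using (Bool; true; false; T; not; _∧_; _xor_; if_then_else_)
open import Data.Bool.Properties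
  using (not-involutive; not-distribˡ-xor; xor-same; xor-assoc; xor-identityʳ; T-≡; T-∧; T-irrelevant)
open import Data.Nat
  using (ℕ; zero; suc; _+_; _*_; _∸_; _≤_; _<_; _≥_; _≤?_; _<?_; _≡ᵇ_; _%_; ⌈_/2⌉; ⌊_/2⌋; _⊔_; z≤n; s≤s)
open import Data.Nat.Properties
open import Data.Nat.ListAction using (sum)
open import Data.Nat.ListAction.Properties using (sum-++)
open import Data.Nat.Solver using (module +-*-Solver)
open import Data.List using (List; []; _∷_; length; take; drop; filter; map; _++_; replicate)
open import Data.List.Properties
  using ( map-++; map-∘; map-cong; map-replicate; ++-assoc; ++-identityʳ; length-replicate; length-take
        ; take++drop≡id; filter-all; filter-none; filter-++ )
open import Data.List.Relation.Unary.All as All using (All; []; _∷_)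
import Data.List.Relation.Unary.All.Properties as Allₚ
open import Data.List.Relation.Unary.Linked as Linked using (Linked; []; [-]; _∷_)
import Data.List.Relation.Unary.Linked.Properties as Linkedₚ
open import Data.List.Relation.Unary.Sorted.TotalOrder ≤-totalOrder using (Sorted)
open import Data.List.Relation.Unary.Sorted.TotalOrder.Properties using (↗↭↗⇒≋)
open import Data.List.Relation.Binary.Pointwise using (Pointwise-≡⇒≡)
open import Data.List.Relation.Binary.Permutation.Propositional
  using (_↭_; ↭⇒↭ₛ; ↭-trans; ↭-refl; module PermutationReasoning)
import Data.List.Relation.Binary.Permutation.Propositional.Properties as Permₚ
open import Data.List.Sort.InsertionSort.Base ≤-decTotalOrder using (sort)
import Data.List.Sort.InsertionSort.Properties ≤-decTotalOrder as InsertionSort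
open import Data.Product using (Σ; _×_; _,_; proj₁; proj₂; ∃-syntax)
open import Data.Sum using (_⊎_; inj₁; inj₂)
open import Function using (_∘_)
open import Function.Bundles using (Equivalence; _↔_; mk↔ₛ′)
open import Relation.Nullary using (¬_; Dec; yes; no)
open import Relation.Nullary.Decidable using (does; dec-true; dec-false)
open import Relation.Binary.PropositionalEquality
open import Algebra.Solver.CommutativeMonoid (Permₚ.++-commutativeMonoid {A = ℕ})
  using (_⊜_; _⊕_) renaming (solve to ↭-solve)
open +-*-Solver using (solve; _:+_; _:*_; _:=_; con)

T-does : ∀ {P : Set} (P? : Dec P) → P → T (does P?)
T-does P? p = Equivalence.from T-≡ (dec-true P? p)

T-does⁻ : ∀ {P : Set} (P? : Dec P) → T (does P?) → P
T-does⁻ (yes p) _ = p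
T-does⁻ (no _) ()

T-∧⁺ : ∀ {a b} → T a → T b → T (a ∧ b)
T-∧⁺ ta tb = Equivalence.from T-∧ (ta , tb)

T-∧⁻ : ∀ {a b} → T (a ∧ b) → T a × T b
T-∧⁻ = Equivalence.to T-∧

≡ᵇ-true : ∀ {m n} → m ≡ n → (m ≡ᵇ n) ≡ true
≡ᵇ-true {m} {n} = dec-true (m ≟ n)

≡ᵇ-false : ∀ {m n} → m ≢ n → (m ≡ᵇ n) ≡ false
≡ᵇ-false {m} {n} = dec-false (m ≟ n)

bit : Bool → ℕ
bit false = 0
bit true = 1

-- `runLengths` and `dur2` are defined through local helpers that are out of scope here.  Each
-- metavariable below is solved by unifying it with such a helper; the `with` turns the helper's
-- literal initial argument into a variable, which puts the problem in the pattern fragment.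
mutual
  runLengthsFrom : ℕ → ℕ → List ℕ → List ℕ
  runLengthsFrom = _

  runLengths-∷ : ∀ x xs → runLengths (x ∷ xs) ≡ runLengthsFrom x 1 xs
  runLengths-∷ x xs with 1
  ... | _ = refl

mutual
  dur2From : ℕ → List ℕ → ℕ
  dur2From = _

  dur2≡dur2From : ∀ xs → dur2 xs ≡ dur2From 1 xs
  dur2≡dur2From xs with 1
  ... | _ = refl

xor-cancel-middle : ∀ a b c → (a xor b) xor (b xor c) ≡ a xor c
xor-cancel-middle false false c = refl
xor-cancel-middle false true c = not-involutive c
xor-cancel-middle true false c = refl
xor-cancel-middle true true c = refl

isOdd-suc : ∀ n → isOdd (suc n) ≡ not (isOdd n)
isOdd-suc zero = refl
isOdd-suc (suc n) = trans (sym (not-involutive _)) (cong not (sym (isOdd-suc n)))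

isOdd-+ : ∀ m n → isOdd (m + n) ≡ isOdd m xor isOdd n
isOdd-+ zero n = refl
isOdd-+ (suc m) n = begin
  isOdd (suc (m + n))        ≡⟨ isOdd-suc (m + n) ⟩
  not (isOdd (m + n))        ≡⟨ cong not (isOdd-+ m n) ⟩
  not (isOdd m xor isOdd n)  ≡⟨ not-distribˡ-xor (isOdd m) (isOdd n) ⟩
  not (isOdd m) xor isOdd n  ≡⟨ cong (_xor isOdd n) (sym (isOdd-suc m)) ⟩
  isOdd (suc m) xor isOdd n  ∎
  where open ≡-Reasoning

isOdd-2* : ∀ a → isOdd (2 * a) ≡ false
isOdd-2* a = begin
  isOdd (a + (a + 0))         ≡⟨ isOdd-+ a (a + 0) ⟩
  isOdd a xor isOdd (a + 0)   ≡⟨ cong (λ b → isOdd a xor isOdd b) (+-identityʳ a) ⟩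
  isOdd a xor isOdd a         ≡⟨ xor-same (isOdd a) ⟩
  false                       ∎
  where open ≡-Reasoning

isOdd-2*+ : ∀ a c → isOdd (2 * a + c) ≡ isOdd c
isOdd-2*+ a c = trans (isOdd-+ (2 * a) c) (cong (_xor isOdd c) (isOdd-2* a))

isOdd-bit : ∀ b → isOdd (bit b) ≡ b
isOdd-bit false = refl
isOdd-bit true = refl

isOdd-bit+ : ∀ b n → isOdd (bit b + n) ≡ b xor isOdd n
isOdd-bit+ false n = refl
isOdd-bit+ true n = isOdd-suc n

isOdd-∸ : ∀ {h x} → h ≤ x → isOdd (x ∸ h) ≡ isOdd x xor isOdd h
isOdd-∸ {h} {x} h≤x = begin
  isOdd (x ∸ h)                                ≡⟨ xor-identityʳ (isOdd (x ∸ h)) ⟨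
  isOdd (x ∸ h) xor false                      ≡⟨ cong (isOdd (x ∸ h) xor_) (xor-same (isOdd h)) ⟨
  isOdd (x ∸ h) xor (isOdd h xor isOdd h)      ≡⟨ xor-assoc (isOdd (x ∸ h)) (isOdd h) (isOdd h) ⟨
  (isOdd (x ∸ h) xor isOdd h) xor isOdd h      ≡⟨ cong (_xor isOdd h) (isOdd-+ (x ∸ h) h) ⟨
  isOdd (x ∸ h + h) xor isOdd h                ≡⟨ cong (λ y → isOdd y xor isOdd h) (m∸n+n≡m h≤x) ⟩
  isOdd x xor isOdd h                          ∎
  where open ≡-Reasoning

Odd : ℕ → Set
Odd n = T (isOdd n)

2*suc∸1 : ∀ n → 2 * suc n ∸ 1 ≡ suc (2 * n)
2*suc∸1 n = cong (_∸ 1) (*-suc 2 n)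

2*suc[suc]∸1 : ∀ m → 2 * suc (suc m) ∸ 1 ≡ 2 + (2 * suc m ∸ 1)
2*suc[suc]∸1 m = begin
  2 * suc (suc m) ∸ 1    ≡⟨ 2*suc∸1 (suc m) ⟩
  suc (2 * suc m)        ≡⟨ cong suc (*-suc 2 m) ⟩
  2 + suc (2 * m)        ≡⟨ cong (2 +_) (2*suc∸1 m) ⟨
  2 + (2 * suc m ∸ 1)    ∎
  where open ≡-Reasoning

2*suc∸1-odd : ∀ d → Odd (2 * suc d ∸ 1)
2*suc∸1-odd d = subst T (sym (begin
  isOdd (2 * suc d ∸ 1)   ≡⟨ cong isOdd (2*suc∸1 d) ⟩
  isOdd (suc (2 * d))     ≡⟨ isOdd-suc (2 * d) ⟩
  not (isOdd (2 * d))     ≡⟨ cong not (isOdd-2* d) ⟩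
  true                    ∎)) _
  where open ≡-Reasoning

odd-≤-2* : ∀ {x} d → Odd x → x ≤ 2 * d → x ≤ 2 * d ∸ 1
odd-≤-2* {x} d ox x≤2d = ∸-monoˡ-≤ 1 (≤∧≢⇒< x≤2d x≢2d)
  where
  x≢2d : x ≢ 2 * d
  x≢2d refl = subst T (isOdd-2* d) ox

2*⌊n/2⌋≡n : ∀ n → isOdd n ≡ false → 2 * ⌊ n /2⌋ ≡ n
2*⌊n/2⌋≡n zero _ = refl
2*⌊n/2⌋≡n (suc zero) ()
2*⌊n/2⌋≡n (suc (suc n)) even = trans (*-suc 2 ⌊ n /2⌋) (cong (2 +_) (2*⌊n/2⌋≡n n even))

⌊2*n/2⌋≡n : ∀ n → ⌊ 2 * n /2⌋ ≡ n
⌊2*n/2⌋≡n n = sym (trans (n≡⌊n+n/2⌋ n) (cong (λ m → ⌊ n + m /2⌋) (sym (+-identityʳ n))))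

n≡⌈n/2⌉∸bit+⌈n/2⌉ : ∀ n → n ≡ (⌈ n /2⌉ ∸ bit (isOdd n)) + ⌈ n /2⌉
n≡⌈n/2⌉∸bit+⌈n/2⌉ n = begin
  n                                    ≡⟨ ⌊n/2⌋+⌈n/2⌉≡n n ⟨
  ⌊ n /2⌋ + ⌈ n /2⌉                    ≡⟨ cong (_+ ⌈ n /2⌉) (m+n∸n≡m ⌊ n /2⌋ b) ⟨
  (⌊ n /2⌋ + b ∸ b) + ⌈ n /2⌉          ≡⟨ cong (λ c → (c ∸ b) + ⌈ n /2⌉) (⌈n/2⌉≡⌊n/2⌋+bit n) ⟨
  (⌈ n /2⌉ ∸ b) + ⌈ n /2⌉              ∎
  where
  open ≡-Reasoning
  b = bit (isOdd n)
  ⌈n/2⌉≡⌊n/2⌋+bit : ∀ n → ⌈ n /2⌉ ≡ ⌊ n /2⌋ + bit (isOdd n)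
  ⌈n/2⌉≡⌊n/2⌋+bit zero = refl
  ⌈n/2⌉≡⌊n/2⌋+bit (suc zero) = refl
  ⌈n/2⌉≡⌊n/2⌋+bit (suc (suc n)) = cong suc (⌈n/2⌉≡⌊n/2⌋+bit n)

⌈/2⌉-parity-injective : ∀ a b → ⌈ a /2⌉ ≡ ⌈ b /2⌉ → isOdd a ≡ isOdd b → a ≡ b
⌈/2⌉-parity-injective a b ceil≡ parity≡ = begin
  a                                    ≡⟨ n≡⌈n/2⌉∸bit+⌈n/2⌉ a ⟩
  (⌈ a /2⌉ ∸ bit (isOdd a)) + ⌈ a /2⌉  ≡⟨ cong₂ (λ c p → (c ∸ bit p) + c) ceil≡ parity≡ ⟩
  (⌈ b /2⌉ ∸ bit (isOdd b)) + ⌈ b /2⌉  ≡⟨ n≡⌈n/2⌉∸bit+⌈n/2⌉ b ⟨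
  b                                    ∎
  where open ≡-Reasoning

countOdd : List ℕ → ℕ
countOdd xs = countTrue (map isOdd xs)

countOdd-∷ : ∀ x xs → countOdd (x ∷ xs) ≡ bit (isOdd x) + countOdd xs
countOdd-∷ x xs with isOdd x
... | true = refl
... | false = refl

parityChanges-∷ : ∀ p x xs → parityChanges p (x ∷ xs) ≡ bit (isOdd p xor isOdd x) + parityChanges x xs
parityChanges-∷ p x xs with isOdd p | isOdd x
... | true  | true  = refl
... | true  | false = refl
... | false | true  = refl
... | false | false = refl

parityChanges-single : ∀ p x → parityChanges p (x ∷ []) ≡ bit (isOdd p xor isOdd x)
parityChanges-single p x = trans (parityChanges-∷ p x []) (+-identityʳ (bit (isOdd p xor isOdd x)))

parityChanges-++ : ∀ p xs y ys →
  parityChanges p (xs ++ y ∷ ys) ≡ parityChanges p (xs ++ y ∷ []) + parityChanges y ys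
parityChanges-++ p [] y ys =
  trans (parityChanges-∷ p y ys) (cong (_+ parityChanges y ys) (sym (parityChanges-single p y)))
parityChanges-++ p (x ∷ xs) y ys = begin
  parityChanges p (x ∷ xs ++ y ∷ ys)                        ≡⟨ parityChanges-∷ p x (xs ++ y ∷ ys) ⟩
  δ + parityChanges x (xs ++ y ∷ ys)                        ≡⟨ cong (δ +_) (parityChanges-++ x xs y ys) ⟩
  δ + (parityChanges x (xs ++ y ∷ []) + parityChanges y ys) ≡⟨ +-assoc δ (parityChanges x (xs ++ y ∷ [])) _ ⟨
  δ + parityChanges x (xs ++ y ∷ []) + parityChanges y ys
    ≡⟨ cong (_+ parityChanges y ys) (parityChanges-∷ p x (xs ++ y ∷ [])) ⟨
  parityChanges p (x ∷ xs ++ y ∷ []) + parityChanges y ys   ∎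
  where
  open ≡-Reasoning
  δ = bit (isOdd p xor isOdd x)

parityChanges-run : ∀ p n x xs →
  parityChanges p (replicate (suc n) x ++ xs) ≡ bit (isOdd p xor isOdd x) + parityChanges x xs
parityChanges-run p zero x xs = parityChanges-∷ p x xs
parityChanges-run p (suc n) x xs = begin
  parityChanges p (x ∷ replicate (suc n) x ++ xs)     ≡⟨ parityChanges-∷ p x (replicate (suc n) x ++ xs) ⟩
  δ + parityChanges x (replicate (suc n) x ++ xs)     ≡⟨ cong (δ +_) (parityChanges-run x n x xs) ⟩
  δ + (bit (isOdd x xor isOdd x) + parityChanges x xs)
    ≡⟨ cong (λ b → δ + (bit b + parityChanges x xs)) (xor-same (isOdd x)) ⟩
  δ + parityChanges x xs                              ∎
  where
  open ≡-Reasoning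
  δ = bit (isOdd p xor isOdd x)

parityChanges-parity : ∀ p xs y → isOdd (parityChanges p (xs ++ y ∷ [])) ≡ isOdd p xor isOdd y
parityChanges-parity p [] y =
  trans (cong isOdd (parityChanges-single p y)) (isOdd-bit (isOdd p xor isOdd y))
parityChanges-parity p (x ∷ xs) y = begin
  isOdd (parityChanges p (x ∷ xs ++ y ∷ [])) ≡⟨ cong isOdd (parityChanges-∷ p x (xs ++ y ∷ [])) ⟩
  isOdd (bit (a xor b) + n)                  ≡⟨ isOdd-bit+ (a xor b) n ⟩
  (a xor b) xor isOdd n                      ≡⟨ cong ((a xor b) xor_) (parityChanges-parity x xs y) ⟩
  (a xor b) xor (b xor c)                    ≡⟨ xor-cancel-middle a b c ⟩
  a xor c                                    ∎
  where
  open ≡-Reasoning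
  n = parityChanges x (xs ++ y ∷ [])
  a = isOdd p
  b = isOdd x
  c = isOdd y

parityChange-+ : ∀ p n → isOdd p xor isOdd (p + n) ≡ isOdd n
parityChange-+ p n = trans (cong (isOdd p xor_) (isOdd-+ p n)) (xor-cancel-middle false (isOdd p) (isOdd n))

allOdd⇒All : ∀ xs → T (allOdd xs) → All Odd xs
allOdd⇒All [] _ = []
allOdd⇒All (x ∷ xs) t = proj₁ (T-∧⁻ t) ∷ allOdd⇒All xs (proj₂ (T-∧⁻ t))

All⇒allOdd : ∀ {xs} → All Odd xs → T (allOdd xs)
All⇒allOdd [] = _
All⇒allOdd (ox ∷ oxs) = T-∧⁺ ox (All⇒allOdd oxs)

nonIncr⇒Linked : ∀ xs → T (nonIncr xs) → Linked _≥_ xs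
nonIncr⇒Linked [] _ = []
nonIncr⇒Linked (x ∷ []) _ = [-]
nonIncr⇒Linked (x ∷ y ∷ ys) t = T-does⁻ (y ≤? x) (proj₁ (T-∧⁻ t)) ∷ nonIncr⇒Linked (y ∷ ys) (proj₂ (T-∧⁻ t))

Linked⇒nonIncr : ∀ {xs} → Linked _≥_ xs → T (nonIncr xs)
Linked⇒nonIncr [] = _
Linked⇒nonIncr [-] = _
Linked⇒nonIncr (y≤x ∷ l↓) = T-∧⁺ (T-does (_ ≤? _) y≤x) (Linked⇒nonIncr l↓)

linked-++-via : ∀ {A : Set} {R : A → A → Set} → (∀ {x y z} → R x y → R y z → R x z) →
  ∀ xs {s ys} → Linked R (xs ++ s ∷ []) → Linked R (s ∷ ys) → Linked R (xs ++ ys)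
linked-++-via R-trans [] _ s↓ = Linked.tail s↓
linked-++-via R-trans (x ∷ []) _ [-] = [-]
linked-++-via R-trans (x ∷ []) (x~s ∷ _) (s~y ∷ ys↓) = R-trans x~s s~y ∷ ys↓
linked-++-via R-trans (x ∷ x′ ∷ xs) (x~x′ ∷ l) s↓ = x~x′ ∷ linked-++-via R-trans (x′ ∷ xs) l s↓

descends-++ : ∀ {b y xs ys} → Linked _≥_ (b ∷ xs) → All (y ≤_) xs → y ≤ b → Linked _≥_ (y ∷ ys) →
  Linked _≥_ (b ∷ xs ++ ys)
descends-++ {xs = []} _ _ y≤b [-] = [-]
descends-++ {xs = []} _ _ y≤b (z≤y ∷ ys↓) = ≤-trans z≤y y≤b ∷ ys↓
descends-++ {xs = x ∷ xs} (x≤b ∷ xs↓) (y≤x ∷ xs≥y) _ ys↓ = x≤b ∷ descends-++ xs↓ xs≥y y≤x ys↓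

ascends-replicate : ∀ {b x ys} n → b ≤ x → Linked _≤_ (x ∷ ys) → Linked _≤_ (b ∷ replicate n x ++ ys)
ascends-replicate zero b≤x [-] = [-]
ascends-replicate zero b≤x (x≤y ∷ ys↑) = ≤-trans b≤x x≤y ∷ ys↑
ascends-replicate (suc n) b≤x ys↑ = b≤x ∷ ascends-replicate n ≤-refl ys↑

headOr : ℕ → List ℕ → ℕ
headOr c [] = c
headOr c (x ∷ _) = x

headOr-≤ : ∀ {c} x xs → Linked _≥_ (x ∷ xs ++ c ∷ []) → headOr c xs ≤ x
headOr-≤ x [] (c≤x ∷ _) = c≤x
headOr-≤ x (y ∷ _) (y≤x ∷ _) = y≤x

headOr-odd : ∀ {c} xs → All Odd xs → Odd c → Odd (headOr c xs)
headOr-odd [] _ oc = oc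
headOr-odd (_ ∷ _) (oy ∷ _) _ = oy

part-suc-≤ : ∀ {l} → Linked _≥_ l → ∀ j → part (suc (suc j)) l ≤ part (suc j) l
part-suc-≤ [] j = z≤n
part-suc-≤ [-] j = z≤n
part-suc-≤ (y≤x ∷ _) zero = y≤x
part-suc-≤ (_ ∷ l↓) (suc j) = part-suc-≤ l↓ j

part-antitone : ∀ {l} → Linked _≥_ l → ∀ i n → part (suc (i + n)) l ≤ part (suc i) l
part-antitone {l} l↓ i zero = ≤-reflexive (cong (λ j → part (suc j) l) (+-identityʳ i))
part-antitone {l} l↓ i (suc n) = begin
  part (suc (i + suc n)) l   ≡⟨ cong (λ j → part (suc j) l) (+-suc i n) ⟩
  part (suc (suc (i + n))) l ≤⟨ part-suc-≤ l↓ (i + n) ⟩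
  part (suc (i + n)) l       ≤⟨ part-antitone l↓ i n ⟩
  part (suc i) l             ∎
  where open ≤-Reasoning

part-length : ∀ d l → 1 ≤ part d l → d ≤ length l
part-length zero l _ = z≤n
part-length (suc d) [] ()
part-length (suc zero) (x ∷ xs) _ = s≤s z≤n
part-length (suc (suc d)) (x ∷ xs) pos = s≤s (part-length (suc d) xs pos)

part-++ʳ : ∀ xs ys j → part (suc (length xs + j)) (xs ++ ys) ≡ part (suc j) ys
part-++ʳ [] ys j = refl
part-++ʳ (x ∷ xs) ys j = part-++ʳ xs ys j

part-1-≤ : ∀ {b xs} → Linked _≥_ (b ∷ xs) → part 1 xs ≤ b
part-1-≤ [-] = z≤n
part-1-≤ (x≤b ∷ _) = x≤b

part-length-≥ : ∀ {c} xs ys → Linked _≥_ (xs ++ c ∷ []) → 1 ≤ length xs → c ≤ part (length xs) (xs ++ ys)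
part-length-≥ (x ∷ []) ys (c≤x ∷ _) _ = c≤x
part-length-≥ (x ∷ x′ ∷ xs) ys (_ ∷ l↓) _ = part-length-≥ (x′ ∷ xs) ys l↓ (s≤s z≤n)

take-descends : ∀ d c l → Linked _≥_ l → c ≤ part d l → Linked _≥_ (take d l ++ c ∷ [])
take-descends zero c l _ _ = [-]
take-descends (suc d) c [] _ _ = [-]
take-descends (suc zero) c (x ∷ xs) _ c≤x = c≤x ∷ [-]
take-descends (suc (suc d)) c (x ∷ []) _ c≤0 = ≤-trans c≤0 z≤n ∷ [-]
take-descends (suc (suc d)) c (x ∷ y ∷ ys) (y≤x ∷ l↓) c≤ = y≤x ∷ take-descends (suc d) c (y ∷ ys) l↓ c≤

drop-descends : ∀ d b l → Linked _≥_ l → part (suc d) l ≤ b → Linked _≥_ (b ∷ drop d l)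
drop-descends zero b [] _ _ = [-]
drop-descends zero b (x ∷ xs) l↓ x≤b = x≤b ∷ l↓
drop-descends (suc d) b [] _ _ = [-]
drop-descends (suc d) b (x ∷ xs) l↓ le = drop-descends d b xs (Linked.tail l↓) le

take-length-++ : ∀ {A : Set} (xs ys : List A) → take (length xs) (xs ++ ys) ≡ xs
take-length-++ [] ys = refl
take-length-++ (x ∷ xs) ys = cong (x ∷_) (take-length-++ xs ys)

drop-length-++ : ∀ {A : Set} (xs ys : List A) → drop (length xs) (xs ++ ys) ≡ ys
drop-length-++ [] ys = refl
drop-length-++ (x ∷ xs) ys = drop-length-++ xs ys

replicate-∷ʳ : ∀ {A : Set} n (x : A) → replicate n x ++ x ∷ [] ≡ replicate (suc n) x
replicate-∷ʳ zero x = refl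
replicate-∷ʳ (suc n) x = cong (x ∷_) (replicate-∷ʳ n x)

sort-unique : ∀ {xs ys} → xs ↭ ys → Sorted ys → sort xs ≡ ys
sort-unique {xs} xs↭ys ys↗ = Pointwise-≡⇒≡ (↗↭↗⇒≋ ≤-totalOrder (InsertionSort.sort-↗ xs) ys↗
  (↭⇒↭ₛ (↭-trans (InsertionSort.sort-↭ xs) xs↭ys)))

-- The 2-modular Durfee size

attained-in-tail : ∀ {i x xs D} → D ≡ dur2From (suc i) xs →
  ∃[ t ] dur2From (suc i) xs ≡ suc i + t × 2 * (suc i + t) ∸ 1 ≤ part (suc t) xs →
  ∃[ t ] D ≡ i + t × 2 * (i + t) ∸ 1 ≤ part (suc t) (x ∷ xs)
attained-in-tail {i} {xs = xs} D≡ (t , eq , le) =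
  suc t , trans D≡ (trans eq (sym (+-suc i t))) , subst (λ j → 2 * j ∸ 1 ≤ part (suc t) xs) (sym (+-suc i t)) le

dur2From-attained : ∀ i xs → 1 ≤ dur2From i xs →
  ∃[ t ] dur2From i xs ≡ i + t × 2 * (i + t) ∸ 1 ≤ part (suc t) xs
dur2From-attained i (x ∷ xs) pos with 2 * i ∸ 1 ≤? x
... | no ¬p rewrite dec-false (2 * i ∸ 1 ≤? x) ¬p = attained-in-tail refl (dur2From-attained (suc i) xs pos)
... | yes p rewrite dec-true (2 * i ∸ 1 ≤? x) p with ⊔-sel i (dur2From (suc i) xs)
...   | inj₁ eq = 0 , trans eq (sym (+-identityʳ i)) , subst (λ j → 2 * j ∸ 1 ≤ x) (sym (+-identityʳ i)) p
...   | inj₂ eq = attained-in-tail eq (dur2From-attained (suc i) xs (subst (1 ≤_) eq pos))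

dur2From-maximal : ∀ i xs t → 1 ≤ i → 2 * (i + t) ∸ 1 ≤ part (suc t) xs → i + t ≤ dur2From i xs
dur2From-maximal (suc i) [] t _ le with () ← subst (_≤ 0) (2*suc∸1 (i + t)) le
dur2From-maximal i (x ∷ xs) zero _ le
  with le′ ← subst (λ j → 2 * j ∸ 1 ≤ x) (+-identityʳ i) le
  rewrite dec-true (2 * i ∸ 1 ≤? x) le′ =
  subst (_≤ i ⊔ dur2From (suc i) xs) (sym (+-identityʳ i)) (m≤m⊔n i (dur2From (suc i) xs))
dur2From-maximal i (x ∷ xs) (suc t) 1≤i le = begin
  i + suc t            ≡⟨ +-suc i t ⟩
  suc i + t            ≤⟨ dur2From-maximal (suc i) xs t (m≤n⇒m≤1+n 1≤i) le′ ⟩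
  dur2From (suc i) xs  ≤⟨ m≤n⊔m _ (dur2From (suc i) xs) ⟩
  dur2From i (x ∷ xs)  ∎
  where
  open ≤-Reasoning
  le′ : 2 * (suc i + t) ∸ 1 ≤ part (suc t) xs
  le′ = subst (λ j → 2 * j ∸ 1 ≤ part (suc t) xs) (+-suc i t) le

dur2-attained : ∀ l d → dur2 l ≡ suc d → 2 * suc d ∸ 1 ≤ part (suc d) l
dur2-attained l d eq with dur2From-attained 1 l (subst (1 ≤_) (sym eq) (s≤s z≤n))
... | t , eq′ , le with refl ← suc-injective (trans (sym eq) eq′) = le

dur2-maximal : ∀ l d → 2 * suc d ∸ 1 ≤ part (suc d) l → suc d ≤ dur2 l
dur2-maximal l d le = dur2From-maximal 1 l d (s≤s z≤n) le

dur2-bounds : ∀ l d → dur2 l ≡ suc d → 2 * suc d ∸ 1 ≤ part (suc d) l × part (2 + d) l ≤ 2 * suc d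
dur2-bounds l d eq = dur2-attained l d eq , ≤-pred (subst (part (2 + d) l <_) (2*suc∸1 (suc d)) (≰⇒> beyond))
  where
  beyond : ¬ (2 * suc (suc d) ∸ 1 ≤ part (2 + d) l)
  beyond le = n≮n (suc d) (subst (suc (suc d) ≤_) eq (dur2-maximal l (suc d) le))

bounds-dur2 : ∀ l d → Linked _≥_ l → 2 * suc d ∸ 1 ≤ part (suc d) l → part (2 + d) l ≤ 2 * suc d →
  dur2 l ≡ suc d
bounds-dur2 l d l↓ lower upper = ≤-antisym (at-most (dur2 l) refl) (dur2-maximal l d lower)
  where
  at-most : ∀ D → dur2 l ≡ D → D ≤ suc d
  at-most zero _ = z≤n
  at-most (suc D) eq = ≮⇒≥ λ d<D → <-irrefl refl (begin-strict
    2 * D                                <⟨ n<1+n (2 * D) ⟩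
    suc (2 * D)                          ≡⟨ 2*suc∸1 D ⟨
    2 * suc D ∸ 1                        ≤⟨ dur2-attained l D eq ⟩
    part (suc D) l                       ≡⟨ cong (λ j → part (suc j) l) (m+[n∸m]≡n (≤-pred d<D)) ⟨
    part (suc (suc d + (D ∸ suc d))) l   ≤⟨ part-antitone l↓ (suc d) (D ∸ suc d) ⟩
    part (2 + d) l                       ≤⟨ upper ⟩
    2 * suc d                            ≤⟨ *-monoʳ-≤ 2 (≤-pred d<D) ⟩
    2 * D                                ∎)
    where open ≤-Reasoning

dur2-++ : ∀ d xs ys → length xs ≡ suc d → Linked _≥_ (xs ++ ys) →
  Linked _≥_ (xs ++ 2 * suc d ∸ 1 ∷ []) → Linked _≥_ (2 * suc d ∷ ys) → dur2 (xs ++ ys) ≡ suc d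
dur2-++ d xs ys |xs| l↓ xs↓ ys↓ = bounds-dur2 (xs ++ ys) d l↓ lower upper
  where
  lower : 2 * suc d ∸ 1 ≤ part (suc d) (xs ++ ys)
  lower = subst (λ j → 2 * suc d ∸ 1 ≤ part j (xs ++ ys)) |xs|
            (part-length-≥ xs ys xs↓ (subst (1 ≤_) (sym |xs|) (s≤s z≤n)))
  upper : part (2 + d) (xs ++ ys) ≤ 2 * suc d
  upper = begin
    part (2 + d) (xs ++ ys)                ≡⟨ cong (λ j → part (suc j) (xs ++ ys)) (sym (+-identityʳ _)) ⟩
    part (2 + d + 0) (xs ++ ys)            ≡⟨ cong (λ j → part (suc (j + 0)) (xs ++ ys)) |xs| ⟨
    part (suc (length xs + 0)) (xs ++ ys)  ≡⟨ part-++ʳ xs ys 0 ⟩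
    part 1 ys                              ≤⟨ part-1-≤ ys↓ ⟩
    2 * suc d                              ∎
    where open ≤-Reasoning

-- Distinct partitions and gap vectors

fromGaps : List ℕ → List ℕ
fromGaps [] = []
fromGaps (g ∷ gs) = g + suc (headOr 0 (fromGaps gs)) ∷ fromGaps gs

toGaps : List ℕ → List ℕ
toGaps [] = []
toGaps (x ∷ xs) = x ∸ suc (headOr 0 xs) ∷ toGaps xs

length-fromGaps : ∀ v → length (fromGaps v) ≡ length v
length-fromGaps [] = refl
length-fromGaps (g ∷ gs) = cong suc (length-fromGaps gs)

strictDec-fromGaps : ∀ v → T (strictDec (fromGaps v))
strictDec-fromGaps [] = _
strictDec-fromGaps (g ∷ []) = T-does (1 ≤? g + 1) (m≤n+m 1 g)
strictDec-fromGaps (g ∷ g′ ∷ gs) =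
  T-∧⁺ (T-does (_ <? _) (m≤n+m _ g)) (strictDec-fromGaps (g′ ∷ gs))

strictDec-∷⁻ : ∀ x xs → T (strictDec (x ∷ xs)) → headOr 0 xs < x × T (strictDec xs)
strictDec-∷⁻ x [] t = T-does⁻ (1 ≤? x) t , _
strictDec-∷⁻ x (y ∷ ys) t = T-does⁻ (y <? x) (proj₁ (T-∧⁻ t)) , proj₂ (T-∧⁻ t)

toGaps-fromGaps : ∀ v → toGaps (fromGaps v) ≡ v
toGaps-fromGaps [] = refl
toGaps-fromGaps (g ∷ gs) = cong₂ _∷_ (m+n∸n≡m g (suc (headOr 0 (fromGaps gs)))) (toGaps-fromGaps gs)

fromGaps-toGaps : ∀ l → T (strictDec l) → fromGaps (toGaps l) ≡ l
fromGaps-toGaps [] _ = refl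
fromGaps-toGaps (x ∷ xs) t with strictDec-∷⁻ x xs t
... | head<x , t′ rewrite fromGaps-toGaps xs t′ = cong (_∷ xs) (m∸n+n≡m head<x)

gapRuns : ℕ → ℕ → List ℕ → List ℕ
gapRuns len g [] = len ∷ []
gapRuns len zero (g′ ∷ gs) = gapRuns (suc len) g′ gs
gapRuns len (suc _) (g′ ∷ gs) = len ∷ gapRuns 1 g′ gs

runLengthsFrom-fromGaps : ∀ g gs len →
  runLengthsFrom (headOr 0 (fromGaps (g ∷ gs))) len (fromGaps gs) ≡ gapRuns len g gs
runLengthsFrom-fromGaps g [] len = refl
runLengthsFrom-fromGaps zero (g′ ∷ gs) len
  rewrite ≡ᵇ-true (refl {x = suc (g′ + suc (headOr 0 (fromGaps gs)))}) =
  runLengthsFrom-fromGaps g′ gs (suc len)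
runLengthsFrom-fromGaps (suc h) (g′ ∷ gs) len
  rewrite ≡ᵇ-false (m≢1+n+m (suc (g′ + suc (headOr 0 (fromGaps gs)))) {h}) =
  cong (len ∷_) (runLengthsFrom-fromGaps g′ gs 1)

oddSequences-fromGaps : ∀ g gs → oddSequences (fromGaps (g ∷ gs)) ≡ countOdd (gapRuns 1 g gs)
oddSequences-fromGaps g gs =
  cong countOdd (trans (runLengths-∷ (headOr 0 (fromGaps (g ∷ gs))) (fromGaps gs)) (runLengthsFrom-fromGaps g gs 1))

withMultiplicities : ℕ → List ℕ → List ℕ
withMultiplicities j [] = []
withMultiplicities j (m ∷ ms) = replicate m j ++ withMultiplicities (suc j) ms

map-withMultiplicities : ∀ j ms → map (2 +_) (withMultiplicities j ms) ≡ withMultiplicities (2 + j) ms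
map-withMultiplicities j [] = refl
map-withMultiplicities j (m ∷ ms) rewrite map-++ (2 +_) (replicate m j) (withMultiplicities (suc j) ms)
  | map-replicate (2 +_) m j | map-withMultiplicities (suc j) ms = refl

-- Reading 0, 1^{g₁}, 2^{g₂}, …, k^{g_k}, k from the left, the parity changes happen exactly
-- between consecutive values that occur, i.e. across the runs of the gap vector.
parityChanges-withMultiplicities : ∀ g gs p len j → p + len ≡ j →
  parityChanges p (withMultiplicities j (g ∷ gs) ++ j + length gs ∷ []) ≡ countOdd (gapRuns len g gs)
parityChanges-withMultiplicities g [] p len j p+len≡j = begin
  parityChanges p ((replicate g j ++ []) ++ j + 0 ∷ [])
    ≡⟨ cong₂ (λ xs i → parityChanges p (xs ++ i ∷ [])) (++-identityʳ (replicate g j)) (+-identityʳ j) ⟩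
  parityChanges p (replicate g j ++ j ∷ [])
    ≡⟨ cong (parityChanges p) (trans (replicate-∷ʳ g j) (sym (++-identityʳ (replicate (suc g) j)))) ⟩
  parityChanges p (replicate (suc g) j ++ [])
    ≡⟨ parityChanges-run p g j [] ⟩
  bit (isOdd p xor isOdd j) + 0
    ≡⟨ cong (λ i → bit (isOdd p xor isOdd i) + 0) p+len≡j ⟨
  bit (isOdd p xor isOdd (p + len)) + 0
    ≡⟨ cong (λ b → bit b + 0) (parityChange-+ p len) ⟩
  bit (isOdd len) + 0
    ≡⟨ countOdd-∷ len [] ⟨
  countOdd (len ∷ []) ∎
  where open ≡-Reasoning
parityChanges-withMultiplicities zero (g′ ∷ gs) p len j p+len≡j = begin
  parityChanges p (withMultiplicities (suc j) (g′ ∷ gs) ++ j + suc (length gs) ∷ [])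
    ≡⟨ cong (λ i → parityChanges p (withMultiplicities (suc j) (g′ ∷ gs) ++ i ∷ [])) (+-suc j (length gs)) ⟩
  parityChanges p (withMultiplicities (suc j) (g′ ∷ gs) ++ suc j + length gs ∷ [])
    ≡⟨ parityChanges-withMultiplicities g′ gs p (suc len) (suc j) (trans (+-suc p len) (cong suc p+len≡j)) ⟩
  countOdd (gapRuns (suc len) g′ gs) ∎
  where open ≡-Reasoning
parityChanges-withMultiplicities (suc h) (g′ ∷ gs) p len j p+len≡j = begin
  parityChanges p ((replicate (suc h) j ++ W) ++ j + suc (length gs) ∷ [])
    ≡⟨ cong (parityChanges p) (++-assoc (replicate (suc h) j) W _) ⟩
  parityChanges p (replicate (suc h) j ++ W ++ j + suc (length gs) ∷ [])
    ≡⟨ parityChanges-run p h j _ ⟩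
  bit (isOdd p xor isOdd j) + parityChanges j (W ++ j + suc (length gs) ∷ [])
    ≡⟨ cong₂ _+_ (cong bit run-parity) (cong (λ i → parityChanges j (W ++ i ∷ [])) (+-suc j (length gs))) ⟩
  bit (isOdd len) + parityChanges j (W ++ suc j + length gs ∷ [])
    ≡⟨ cong (bit (isOdd len) +_) (parityChanges-withMultiplicities g′ gs j 1 (suc j) (+-comm j 1)) ⟩
  bit (isOdd len) + countOdd (gapRuns 1 g′ gs)
    ≡⟨ countOdd-∷ len (gapRuns 1 g′ gs) ⟨
  countOdd (len ∷ gapRuns 1 g′ gs) ∎
  where
  open ≡-Reasoning
  W = withMultiplicities (suc j) (g′ ∷ gs)
  run-parity : isOdd p xor isOdd j ≡ isOdd len
  run-parity = trans (cong (λ i → isOdd p xor isOdd i) (sym p+len≡j)) (parityChange-+ p len)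

oddSequences-parity : ∀ v → isOdd (oddSequences (fromGaps v)) ≡ isOdd (length v)
oddSequences-parity [] = refl
oddSequences-parity v@(x ∷ r) = begin
  isOdd (oddSequences (fromGaps v))                              ≡⟨ cong isOdd (oddSequences-fromGaps x r) ⟩
  isOdd (countOdd (gapRuns 1 x r))                               ≡⟨ cong isOdd (parityChanges-withMultiplicities x r 0 1 1 refl) ⟨
  isOdd (parityChanges 0 (withMultiplicities 1 v ++ length v ∷ [])) ≡⟨ parityChanges-parity 0 (withMultiplicities 1 v) (length v) ⟩
  isOdd (length v)                                               ∎
  where open ≡-Reasoning

-- The odd partition of a gap vector

oddEntries : List ℕ → List ℕ
oddEntries [] = []
oddEntries (o ∷ []) = o ∷ []
oddEntries (o ∷ _ ∷ v) = o ∷ oddEntries v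

-- The entries v₂, v₄, … padded to length ⌈k/2⌉: the last one is 0 when k is odd and v_k + 1
-- when k is even, so that it records whether the d-th part exceeds 2d - 1.
evenEntries : List ℕ → List ℕ
evenEntries [] = []
evenEntries (_ ∷ []) = 0 ∷ []
evenEntries (_ ∷ e ∷ []) = suc e ∷ []
evenEntries (_ ∷ e ∷ x ∷ v) = e ∷ evenEntries (x ∷ v)

length-oddEntries : ∀ v → length (oddEntries v) ≡ ⌈ length v /2⌉
length-oddEntries [] = refl
length-oddEntries (o ∷ []) = refl
length-oddEntries (o ∷ e ∷ v) = cong suc (length-oddEntries v)

length-evenEntries : ∀ v → length (evenEntries v) ≡ ⌈ length v /2⌉
length-evenEntries [] = refl
length-evenEntries (_ ∷ []) = refl
length-evenEntries (_ ∷ e ∷ []) = refl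
length-evenEntries (_ ∷ e ∷ x ∷ v) = cong suc (length-evenEntries (x ∷ v))

upperParts : ℕ → List ℕ → List ℕ
upperParts c [] = []
upperParts c (e ∷ es) = 2 * e + headOr c (upperParts c es) ∷ upperParts c es

lowerParts : List ℕ → List ℕ
lowerParts [] = []
lowerParts (o ∷ os) = map (2 +_) (lowerParts os) ++ replicate o 1

-- With d = ⌈k/2⌉, the first d parts are 2d - 1 plus twice the suffix sums of `evenEntries v`,
-- and the parts below them are the odd numbers 1, 3, …, 2d - 1 with multiplicities `oddEntries v`.
oddSide : List ℕ → List ℕ
oddSide v = upperParts (2 * ⌈ length v /2⌉ ∸ 1) (evenEntries v) ++ lowerParts (oddEntries v)

length-upperParts : ∀ c es → length (upperParts c es) ≡ length es
length-upperParts c [] = refl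
length-upperParts c (e ∷ es) = cong suc (length-upperParts c es)

headOr-upperParts : ∀ c es → headOr c (upperParts c es) ≡ 2 * sum es + c
headOr-upperParts c [] = refl
headOr-upperParts c (e ∷ es) rewrite headOr-upperParts c es | *-distribˡ-+ 2 e (sum es) =
  sym (+-assoc (2 * e) (2 * sum es) c)

upperParts-descends : ∀ c es → Linked _≥_ (upperParts c es ++ c ∷ [])
upperParts-descends c [] = [-]
upperParts-descends c (e ∷ []) = m≤n+m c (2 * e) ∷ [-]
upperParts-descends c (e ∷ e′ ∷ es) = m≤n+m _ (2 * e) ∷ upperParts-descends c (e′ ∷ es)

upperParts-odd : ∀ c es → Odd c → All Odd (upperParts c es)
upperParts-odd c [] _ = []
upperParts-odd c (e ∷ es) oc = subst T (sym odd) oc ∷ upperParts-odd c es oc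
  where
  odd : isOdd (2 * e + headOr c (upperParts c es)) ≡ isOdd c
  odd = begin
    isOdd (2 * e + headOr c (upperParts c es)) ≡⟨ isOdd-2*+ e _ ⟩
    isOdd (headOr c (upperParts c es))         ≡⟨ cong isOdd (headOr-upperParts c es) ⟩
    isOdd (2 * sum es + c)                     ≡⟨ isOdd-2*+ (sum es) c ⟩
    isOdd c                                    ∎
    where open ≡-Reasoning

lowerParts-descends : ∀ os → Linked _≥_ (2 * length os ∷ lowerParts os)
lowerParts-descends [] = [-]
lowerParts-descends (o ∷ os) = subst (λ b → Linked _≥_ (b ∷ lowerParts (o ∷ os))) (sym (*-suc 2 (length os)))
  (descends-++ (Linkedₚ.map⁺ (Linked.map (λ le → s≤s (s≤s le)) (lowerParts-descends os)))
               (Allₚ.map⁺ (All.universal (λ _ → s≤s z≤n) (lowerParts os)))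
               (s≤s z≤n)
               (ones o))
  where
  ones : ∀ n → Linked _≥_ (1 ∷ replicate n 1)
  ones zero = [-]
  ones (suc n) = ≤-refl ∷ ones n

lowerParts-odd : ∀ os → All Odd (lowerParts os)
lowerParts-odd [] = []
lowerParts-odd (o ∷ os) = Allₚ.++⁺ (Allₚ.map⁺ (lowerParts-odd os)) (Allₚ.replicate⁺ o _)

lowerParts-oddEntries-descends : ∀ v → Linked _≥_ (2 * ⌈ length v /2⌉ ∷ lowerParts (oddEntries v))
lowerParts-oddEntries-descends v =
  subst (λ n → Linked _≥_ (2 * n ∷ lowerParts (oddEntries v))) (length-oddEntries v) (lowerParts-descends (oddEntries v))

descends-below-odd : ∀ d {xs} → All Odd xs → Linked _≥_ (2 * d ∷ xs) → Linked _≥_ (2 * d ∸ 1 ∷ xs)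
descends-below-odd d _ [-] = [-]
descends-below-odd d (ox ∷ _) (x≤2d ∷ xs↓) = odd-≤-2* d ox x≤2d ∷ xs↓

oddSide-descends : ∀ v → Linked _≥_ (oddSide v)
oddSide-descends v = linked-++-via (λ y≤x z≤y → ≤-trans z≤y y≤x) (upperParts c (evenEntries v))
  (upperParts-descends c (evenEntries v))
  (descends-below-odd d (lowerParts-odd (oddEntries v)) (lowerParts-oddEntries-descends v))
  where
  d = ⌈ length v /2⌉
  c = 2 * d ∸ 1

oddSide-odd : ∀ v → All Odd (oddSide v)
oddSide-odd [] = []
oddSide-odd v@(_ ∷ r) = Allₚ.++⁺ (upperParts-odd _ (evenEntries v) (2*suc∸1-odd ⌊ length r /2⌋))
                                (lowerParts-odd (oddEntries v))

dur2-oddSide : ∀ v → dur2 (oddSide v) ≡ ⌈ length v /2⌉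
dur2-oddSide [] = refl
dur2-oddSide v@(_ ∷ r) = dur2-++ ⌊ length r /2⌋ (upperParts c (evenEntries v)) (lowerParts (oddEntries v))
  (trans (length-upperParts c (evenEntries v)) (length-evenEntries v))
  (oddSide-descends v)
  (upperParts-descends c (evenEntries v))
  (lowerParts-oddEntries-descends v)
  where
  c = 2 * ⌈ length v /2⌉ ∸ 1

headOr-map-2+ : ∀ c xs → headOr (2 + c) (map (2 +_) xs) ≡ 2 + headOr c xs
headOr-map-2+ c [] = refl
headOr-map-2+ c (x ∷ xs) = refl

upperParts-+2 : ∀ c es → upperParts (2 + c) es ≡ map (2 +_) (upperParts c es)
upperParts-+2 c [] = refl
upperParts-+2 c (e ∷ es) rewrite upperParts-+2 c es | headOr-map-2+ c (upperParts c es) =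
  cong (_∷ map (2 +_) (upperParts c es))
    (solve 2 (λ a h → a :+ (con 2 :+ h) := con 2 :+ (a :+ h)) refl (2 * e) (headOr c (upperParts c es)))

headOr-oddSide : ∀ x r → headOr 0 (oddSide (x ∷ r)) ≡
  headOr (2 * ⌈ length (x ∷ r) /2⌉ ∸ 1) (upperParts (2 * ⌈ length (x ∷ r) /2⌉ ∸ 1) (evenEntries (x ∷ r)))
headOr-oddSide x [] = refl
headOr-oddSide x (e ∷ []) = refl
headOr-oddSide x (e ∷ y ∷ r) = refl

oddSide-∷∷ : ∀ o e x r → oddSide (o ∷ e ∷ x ∷ r) ≡
  2 + (2 * e + headOr 0 (oddSide (x ∷ r))) ∷ map (2 +_) (oddSide (x ∷ r)) ++ replicate o 1
oddSide-∷∷ o e x r = begin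
  upperParts (2 * suc (suc m) ∸ 1) es ++ map (2 +_) L ++ replicate o 1
    ≡⟨ cong (λ c → upperParts c es ++ map (2 +_) L ++ replicate o 1) (2*suc[suc]∸1 m) ⟩
  upperParts (2 + c) es ++ map (2 +_) L ++ replicate o 1
    ≡⟨ cong (_++ map (2 +_) L ++ replicate o 1) (upperParts-+2 c es) ⟩
  map (2 +_) (upperParts c es) ++ map (2 +_) L ++ replicate o 1
    ≡⟨ ++-assoc (map (2 +_) (upperParts c es)) (map (2 +_) L) (replicate o 1) ⟨
  (map (2 +_) (upperParts c es) ++ map (2 +_) L) ++ replicate o 1
    ≡⟨ cong (_++ replicate o 1) (map-++ (2 +_) (upperParts c es) L) ⟨
  map (2 +_) (upperParts c es ++ L) ++ replicate o 1
    ≡⟨ cong (λ h → 2 + (2 * e + h) ∷ map (2 +_) (oddSide (x ∷ r)) ++ replicate o 1) (headOr-oddSide x r) ⟨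
  2 + (2 * e + headOr 0 (oddSide (x ∷ r))) ∷ map (2 +_) (oddSide (x ∷ r)) ++ replicate o 1 ∎
  where
  open ≡-Reasoning
  m = ⌊ length r /2⌋
  c = 2 * suc m ∸ 1
  es = e ∷ evenEntries (x ∷ r)
  L = lowerParts (oddEntries (x ∷ r))

sum-replicate-1 : ∀ n → sum (replicate n 1) ≡ n
sum-replicate-1 zero = refl
sum-replicate-1 (suc n) = cong suc (sum-replicate-1 n)

sum-hook : ∀ xs n → sum (map (2 +_) xs ++ replicate n 1) ≡ 2 * length xs + sum xs + n
sum-hook [] n = sum-replicate-1 n
sum-hook (x ∷ xs) n rewrite sum-hook xs n =
  solve 4 (λ x l s n → (con 2 :+ x) :+ (con 2 :* l :+ s :+ n) := con 2 :* (con 1 :+ l) :+ (x :+ s) :+ n)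
    refl x (length xs) (sum xs) n

length-hook : ∀ xs n → length (map (2 +_) xs ++ replicate n 1) ≡ length xs + n
length-hook [] n = length-replicate n
length-hook (x ∷ xs) n = cong suc (length-hook xs n)

-- The size alone does not go through the induction: the hook added by `oddSide-∷∷` also
-- depends on the largest part and the number of parts.
OddSideMeasures : List ℕ → Set
OddSideMeasures v =
  sum (oddSide v) ≡ sum (fromGaps v) × headOr 0 (oddSide v) + 2 * length (oddSide v) ≡ suc (2 * headOr 0 (fromGaps v))

oddSide-measures-∷∷ : ∀ x e y r → OddSideMeasures (y ∷ r) → OddSideMeasures (x ∷ e ∷ y ∷ r)
oddSide-measures-∷∷ x e y r (sum≡ , head≡) = sumStep , headStep
  where
  open ≡-Reasoning
  O = oddSide (y ∷ r)
  h = headOr 0 O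
  H = headOr 0 (fromGaps (y ∷ r))
  SF = sum (fromGaps (y ∷ r))
  sumStep : sum (oddSide (x ∷ e ∷ y ∷ r)) ≡ x + suc (e + suc H) + (e + suc H + SF)
  sumStep = begin
    sum (oddSide (x ∷ e ∷ y ∷ r))
      ≡⟨ cong sum (oddSide-∷∷ x e y r) ⟩
    2 + (2 * e + h) + sum (map (2 +_) O ++ replicate x 1)
      ≡⟨ cong (2 + (2 * e + h) +_) (sum-hook O x) ⟩
    2 + (2 * e + h) + (2 * length O + sum O + x)
      ≡⟨ solve 5 (λ e h L S x → con 2 :+ (con 2 :* e :+ h) :+ (con 2 :* L :+ S :+ x)
                                := (h :+ con 2 :* L) :+ (con 2 :+ con 2 :* e :+ S :+ x))
                 refl e h (length O) (sum O) x ⟩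
    (h + 2 * length O) + (2 + 2 * e + sum O + x)
      ≡⟨ cong₂ (λ a b → a + (2 + 2 * e + b + x)) head≡ sum≡ ⟩
    suc (2 * H) + (2 + 2 * e + SF + x)
      ≡⟨ solve 4 (λ e H SF x → con 1 :+ con 2 :* H :+ (con 2 :+ con 2 :* e :+ SF :+ x)
                               := x :+ (con 1 :+ (e :+ (con 1 :+ H))) :+ (e :+ (con 1 :+ H) :+ SF))
                 refl e H SF x ⟩
    x + suc (e + suc H) + (e + suc H + SF) ∎
  headStep : headOr 0 (oddSide (x ∷ e ∷ y ∷ r)) + 2 * length (oddSide (x ∷ e ∷ y ∷ r)) ≡
             suc (2 * (x + suc (e + suc H)))
  headStep = begin
    headOr 0 (oddSide (x ∷ e ∷ y ∷ r)) + 2 * length (oddSide (x ∷ e ∷ y ∷ r))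
      ≡⟨ cong (λ l → headOr 0 l + 2 * length l) (oddSide-∷∷ x e y r) ⟩
    2 + (2 * e + h) + 2 * suc (length (map (2 +_) O ++ replicate x 1))
      ≡⟨ cong (λ n → 2 + (2 * e + h) + 2 * suc n) (length-hook O x) ⟩
    2 + (2 * e + h) + 2 * suc (length O + x)
      ≡⟨ solve 4 (λ e h L x → con 2 :+ (con 2 :* e :+ h) :+ con 2 :* (con 1 :+ (L :+ x))
                              := (h :+ con 2 :* L) :+ (con 4 :+ con 2 :* e :+ con 2 :* x))
                 refl e h (length O) x ⟩
    (h + 2 * length O) + (4 + 2 * e + 2 * x)
      ≡⟨ cong (_+ (4 + 2 * e + 2 * x)) head≡ ⟩
    suc (2 * H) + (4 + 2 * e + 2 * x)
      ≡⟨ solve 3 (λ e H x → con 1 :+ con 2 :* H :+ (con 4 :+ con 2 :* e :+ con 2 :* x)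
                            := con 1 :+ con 2 :* (x :+ (con 1 :+ (e :+ (con 1 :+ H)))))
                 refl e H x ⟩
    suc (2 * (x + suc (e + suc H))) ∎

oddSide-measures : ∀ x r → OddSideMeasures (x ∷ r)
oddSide-measures x [] rewrite sum-replicate-1 x | length-replicate x {1} =
  solve 1 (λ x → con 1 :+ x := (x :+ con 1) :+ con 0) refl x ,
  solve 1 (λ x → con 1 :+ con 2 :* (con 1 :+ x) := con 1 :+ con 2 :* (x :+ con 1)) refl x
oddSide-measures x (e ∷ []) rewrite sum-replicate-1 x | length-replicate x {1} =
  solve 2 (λ x e → (con 2 :* (con 1 :+ e) :+ con 1) :+ x
                   := (x :+ (con 1 :+ (e :+ con 1))) :+ ((e :+ con 1) :+ con 0)) refl x e ,
  solve 2 (λ x e → (con 2 :* (con 1 :+ e) :+ con 1) :+ con 2 :* (con 1 :+ x)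
                   := con 1 :+ con 2 :* (x :+ (con 1 :+ (e :+ con 1)))) refl x e
oddSide-measures x (e ∷ y ∷ r) = oddSide-measures-∷∷ x e y r (oddSide-measures y r)

sum-oddSide : ∀ v → sum (oddSide v) ≡ sum (fromGaps v)
sum-oddSide [] = refl
sum-oddSide (x ∷ r) = proj₁ (oddSide-measures x r)

-- Inverting oddSide

upperParts⁻¹ : ℕ → List ℕ → List ℕ
upperParts⁻¹ c [] = []
upperParts⁻¹ c (x ∷ xs) = ⌊ x ∸ headOr c xs /2⌋ ∷ upperParts⁻¹ c xs

length-upperParts⁻¹ : ∀ c xs → length (upperParts⁻¹ c xs) ≡ length xs
length-upperParts⁻¹ c [] = refl
length-upperParts⁻¹ c (x ∷ xs) = cong suc (length-upperParts⁻¹ c xs)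

upperParts⁻¹-upperParts : ∀ c es → upperParts⁻¹ c (upperParts c es) ≡ es
upperParts⁻¹-upperParts c [] = refl
upperParts⁻¹-upperParts c (e ∷ es) =
  cong₂ _∷_ (trans (cong ⌊_/2⌋ (m+n∸n≡m (2 * e) (headOr c (upperParts c es)))) (⌊2*n/2⌋≡n e))
            (upperParts⁻¹-upperParts c es)

upperParts-upperParts⁻¹ : ∀ c xs → Linked _≥_ (xs ++ c ∷ []) → All Odd xs → Odd c →
  upperParts c (upperParts⁻¹ c xs) ≡ xs
upperParts-upperParts⁻¹ c [] _ _ _ = refl
upperParts-upperParts⁻¹ c (x ∷ xs) xs↓ (ox ∷ oxs) oc
  rewrite upperParts-upperParts⁻¹ c xs (Linked.tail xs↓) oxs oc =
  cong (_∷ xs) (trans (cong (_+ headOr c xs) (2*⌊n/2⌋≡n (x ∸ headOr c xs) even)) (m∸n+n≡m next≤x))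
  where
  next≤x : headOr c xs ≤ x
  next≤x = headOr-≤ x xs xs↓
  next-odd : Odd (headOr c xs)
  next-odd = headOr-odd xs oxs oc
  even : isOdd (x ∸ headOr c xs) ≡ false
  even = begin
    isOdd (x ∸ headOr c xs)               ≡⟨ isOdd-∸ next≤x ⟩
    isOdd x xor isOdd (headOr c xs)       ≡⟨ cong₂ _xor_ (Equivalence.to T-≡ ox) (Equivalence.to T-≡ next-odd) ⟩
    false                                 ∎
    where open ≡-Reasoning

ones : List ℕ → ℕ
ones [] = 0
ones (suc (suc _) ∷ xs) = ones xs
ones (_ ∷ xs) = suc (ones xs)

lowerBy2 : List ℕ → List ℕ
lowerBy2 [] = []
lowerBy2 (suc (suc x) ∷ xs) = x ∷ lowerBy2 xs
lowerBy2 (_ ∷ xs) = lowerBy2 xs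

lowerParts⁻¹ : ℕ → List ℕ → List ℕ
lowerParts⁻¹ zero _ = []
lowerParts⁻¹ (suc d) xs = ones xs ∷ lowerParts⁻¹ d (lowerBy2 xs)

length-lowerParts⁻¹ : ∀ d xs → length (lowerParts⁻¹ d xs) ≡ d
length-lowerParts⁻¹ zero xs = refl
length-lowerParts⁻¹ (suc d) xs = cong suc (length-lowerParts⁻¹ d (lowerBy2 xs))

ones-hook : ∀ xs n → ones (map (2 +_) xs ++ replicate n 1) ≡ n
ones-hook (x ∷ xs) n = ones-hook xs n
ones-hook [] zero = refl
ones-hook [] (suc n) = cong suc (ones-hook [] n)

lowerBy2-hook : ∀ xs n → lowerBy2 (map (2 +_) xs ++ replicate n 1) ≡ xs
lowerBy2-hook (x ∷ xs) n = cong (x ∷_) (lowerBy2-hook xs n)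
lowerBy2-hook [] zero = refl
lowerBy2-hook [] (suc n) = lowerBy2-hook [] n

lowerParts⁻¹-lowerParts : ∀ os → lowerParts⁻¹ (length os) (lowerParts os) ≡ os
lowerParts⁻¹-lowerParts [] = refl
lowerParts⁻¹-lowerParts (o ∷ os) rewrite ones-hook (lowerParts os) o | lowerBy2-hook (lowerParts os) o =
  cong (o ∷_) (lowerParts⁻¹-lowerParts os)

ones-only : ∀ {xs} → Linked _≥_ (1 ∷ xs) → All Odd xs → xs ≡ replicate (ones xs) 1 × lowerBy2 xs ≡ []
ones-only [-] [] = refl , refl
ones-only (z≤n ∷ _) (() ∷ _)
ones-only (s≤s z≤n ∷ xs↓) (_ ∷ oxs) with ones-only xs↓ oxs
... | eq , eq′ = cong (1 ∷_) eq , eq′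

lowerParts-split : ∀ xs → Linked _≥_ xs → All Odd xs → map (2 +_) (lowerBy2 xs) ++ replicate (ones xs) 1 ≡ xs
lowerParts-split [] _ _ = refl
lowerParts-split (zero ∷ _) _ (() ∷ _)
lowerParts-split (suc zero ∷ xs) xs↓ (_ ∷ oxs) with ones-only xs↓ oxs
... | eq , eq′ rewrite eq′ = cong (1 ∷_) (sym eq)
lowerParts-split (suc (suc y) ∷ xs) xs↓ (_ ∷ oxs) = cong (2 + y ∷_) (lowerParts-split xs (Linked.tail xs↓) oxs)

lowerBy2-descends : ∀ {b xs} → Linked _≥_ (2 + b ∷ xs) → All Odd xs → Linked _≥_ (b ∷ lowerBy2 xs)
lowerBy2-descends [-] [] = [-]
lowerBy2-descends {b} {suc zero ∷ xs} (_ ∷ xs↓) (_ ∷ oxs) =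
  subst (λ ys → Linked _≥_ (b ∷ ys)) (sym (proj₂ (ones-only xs↓ oxs))) [-]
lowerBy2-descends {xs = suc (suc y) ∷ xs} (s≤s (s≤s y≤b) ∷ xs↓) (_ ∷ oxs) = y≤b ∷ lowerBy2-descends xs↓ oxs

lowerBy2-odd : ∀ {xs} → All Odd xs → All Odd (lowerBy2 xs)
lowerBy2-odd [] = []
lowerBy2-odd {suc zero ∷ xs} (_ ∷ oxs) = lowerBy2-odd oxs
lowerBy2-odd {suc (suc y) ∷ xs} (oy ∷ oxs) = oy ∷ lowerBy2-odd oxs

lowerParts-lowerParts⁻¹ : ∀ d xs → Linked _≥_ (2 * d ∷ xs) → All Odd xs → lowerParts (lowerParts⁻¹ d xs) ≡ xs
lowerParts-lowerParts⁻¹ zero [] _ _ = refl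
lowerParts-lowerParts⁻¹ zero (x ∷ xs) (z≤n ∷ _) (() ∷ _)
lowerParts-lowerParts⁻¹ (suc d) xs xs↓ oxs = begin
  map (2 +_) (lowerParts (lowerParts⁻¹ d (lowerBy2 xs))) ++ replicate (ones xs) 1
    ≡⟨ cong (λ ys → map (2 +_) ys ++ replicate (ones xs) 1)
            (lowerParts-lowerParts⁻¹ d (lowerBy2 xs) (lowerBy2-descends xs↓′ oxs) (lowerBy2-odd oxs)) ⟩
  map (2 +_) (lowerBy2 xs) ++ replicate (ones xs) 1
    ≡⟨ lowerParts-split xs (Linked.tail xs↓) oxs ⟩
  xs ∎
  where
  open ≡-Reasoning
  xs↓′ : Linked _≥_ (2 + 2 * d ∷ xs)
  xs↓′ = subst (λ b → Linked _≥_ (b ∷ xs)) (*-suc 2 d) xs↓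

interleave : List ℕ → List ℕ → List ℕ
interleave (o ∷ []) (zero ∷ _) = o ∷ []
interleave (o ∷ []) (suc e ∷ _) = o ∷ e ∷ []
interleave (o ∷ os@(_ ∷ _)) (e ∷ es) = o ∷ e ∷ interleave os es
interleave _ _ = []

interleave-entries : ∀ v → interleave (oddEntries v) (evenEntries v) ≡ v
interleave-entries [] = refl
interleave-entries (o ∷ []) = refl
interleave-entries (o ∷ e ∷ []) = refl
interleave-entries (o ∷ e ∷ x ∷ []) = refl
interleave-entries (o ∷ e ∷ x ∷ y ∷ v) = cong (λ w → o ∷ e ∷ w) (interleave-entries (x ∷ y ∷ v))

oddEntries-interleave : ∀ o os es → length (o ∷ os) ≡ length es → oddEntries (interleave (o ∷ os) es) ≡ o ∷ os
oddEntries-interleave o [] (zero ∷ []) _ = refl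
oddEntries-interleave o [] (suc e ∷ []) _ = refl
oddEntries-interleave o (o′ ∷ []) (e ∷ zero ∷ []) _ = refl
oddEntries-interleave o (o′ ∷ []) (e ∷ suc e′ ∷ []) _ = refl
oddEntries-interleave o (o′ ∷ o″ ∷ os) (e ∷ e′ ∷ es) eq =
  cong (o ∷_) (oddEntries-interleave o′ (o″ ∷ os) (e′ ∷ es) (suc-injective eq))

evenEntries-interleave : ∀ o os es → length (o ∷ os) ≡ length es → evenEntries (interleave (o ∷ os) es) ≡ es
evenEntries-interleave o [] (zero ∷ []) _ = refl
evenEntries-interleave o [] (suc e ∷ []) _ = refl
evenEntries-interleave o (o′ ∷ []) (e ∷ zero ∷ []) _ = refl
evenEntries-interleave o (o′ ∷ []) (e ∷ suc e′ ∷ []) _ = refl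
evenEntries-interleave o (o′ ∷ o″ ∷ os) (e ∷ e′ ∷ es) eq =
  cong (e ∷_) (evenEntries-interleave o′ (o″ ∷ os) (e′ ∷ es) (suc-injective eq))

length-upper-oddSide : ∀ v → length (upperParts (2 * ⌈ length v /2⌉ ∸ 1) (evenEntries v)) ≡ ⌈ length v /2⌉
length-upper-oddSide v = trans (length-upperParts _ (evenEntries v)) (length-evenEntries v)

take-oddSide : ∀ v → take ⌈ length v /2⌉ (oddSide v) ≡ upperParts (2 * ⌈ length v /2⌉ ∸ 1) (evenEntries v)
take-oddSide v = subst (λ n → take n (oddSide v) ≡ U) (length-upper-oddSide v) (take-length-++ U (lowerParts (oddEntries v)))
  where U = upperParts (2 * ⌈ length v /2⌉ ∸ 1) (evenEntries v)

drop-oddSide : ∀ v → drop ⌈ length v /2⌉ (oddSide v) ≡ lowerParts (oddEntries v)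
drop-oddSide v = subst (λ n → drop n (oddSide v) ≡ lowerParts (oddEntries v)) (length-upper-oddSide v)
  (drop-length-++ (upperParts (2 * ⌈ length v /2⌉ ∸ 1) (evenEntries v)) (lowerParts (oddEntries v)))

oddSide⁻¹ : ℕ → List ℕ → List ℕ
oddSide⁻¹ d l = interleave (lowerParts⁻¹ d (drop d l)) (upperParts⁻¹ (2 * d ∸ 1) (take d l))

oddSide⁻¹-oddSide : ∀ v → oddSide⁻¹ ⌈ length v /2⌉ (oddSide v) ≡ v
oddSide⁻¹-oddSide v = begin
  interleave (lowerParts⁻¹ d (drop d (oddSide v))) (upperParts⁻¹ c (take d (oddSide v)))
    ≡⟨ cong₂ (λ bt tp → interleave (lowerParts⁻¹ d bt) (upperParts⁻¹ c tp)) (drop-oddSide v) (take-oddSide v) ⟩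
  interleave (lowerParts⁻¹ d (lowerParts os)) (upperParts⁻¹ c (upperParts c es))
    ≡⟨ cong₂ (λ n es′ → interleave (lowerParts⁻¹ n (lowerParts os)) es′)
             (sym (length-oddEntries v)) (upperParts⁻¹-upperParts c es) ⟩
  interleave (lowerParts⁻¹ (length os) (lowerParts os)) es
    ≡⟨ cong (λ os′ → interleave os′ es) (lowerParts⁻¹-lowerParts os) ⟩
  interleave os es
    ≡⟨ interleave-entries v ⟩
  v ∎
  where
  open ≡-Reasoning
  d = ⌈ length v /2⌉
  c = 2 * d ∸ 1
  es = evenEntries v
  os = oddEntries v

oddSide-oddSide⁻¹ : ∀ l d → Linked _≥_ l → All Odd l → dur2 l ≡ suc d → oddSide (oddSide⁻¹ (suc d) l) ≡ l
oddSide-oddSide⁻¹ l d l↓ ol eq = begin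
  upperParts (2 * ⌈ length w /2⌉ ∸ 1) (evenEntries w) ++ lowerParts (oddEntries w)
    ≡⟨ cong₂ (λ n es′ → upperParts (2 * n ∸ 1) es′ ++ lowerParts (oddEntries w)) ⌈|w|/2⌉≡D evens ⟩
  upperParts c es ++ lowerParts (oddEntries w)
    ≡⟨ cong₂ _++_ upper-inverse (cong lowerParts odds) ⟩
  tp ++ lowerParts os
    ≡⟨ cong (tp ++_) lower-inverse ⟩
  tp ++ bt
    ≡⟨ take++drop≡id D l ⟩
  l ∎
  where
  open ≡-Reasoning
  D = suc d
  c = 2 * D ∸ 1
  tp = take D l
  bt = drop D l
  es = upperParts⁻¹ c tp
  os = lowerParts⁻¹ D bt
  w = interleave os es
  lower = proj₁ (dur2-bounds l d eq)
  upper = proj₂ (dur2-bounds l d eq)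
  upper-inverse : upperParts c es ≡ tp
  upper-inverse = upperParts-upperParts⁻¹ c tp (take-descends D c l l↓ lower) (Allₚ.take⁺ D ol) (2*suc∸1-odd d)
  lower-inverse : lowerParts os ≡ bt
  lower-inverse = lowerParts-lowerParts⁻¹ D bt (drop-descends D (2 * D) l l↓ upper) (Allₚ.drop⁺ D ol)
  |es| : length es ≡ D
  |es| = trans (length-upperParts⁻¹ c tp) (trans (length-take D l)
           (m≤n⇒m⊓n≡m (part-length D l (≤-trans (subst (1 ≤_) (sym (2*suc∸1 d)) (s≤s z≤n)) lower))))
  |os|≡|es| : length os ≡ length es
  |os|≡|es| = trans (length-lowerParts⁻¹ D bt) (sym |es|)
  evens : evenEntries w ≡ es
  evens = evenEntries-interleave (ones bt) (lowerParts⁻¹ d (lowerBy2 bt)) es |os|≡|es|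
  odds : oddEntries w ≡ os
  odds = oddEntries-interleave (ones bt) (lowerParts⁻¹ d (lowerBy2 bt)) es |os|≡|es|
  ⌈|w|/2⌉≡D : ⌈ length w /2⌉ ≡ D
  ⌈|w|/2⌉≡D = trans (sym (length-evenEntries w)) (trans (cong length evens) |es|)

-- The alternating index of oddSide v

suffixSums : List ℕ → List ℕ
suffixSums [] = []
suffixSums (e ∷ es) = sum (e ∷ es) ∷ suffixSums es

count≥ : ℕ → List ℕ → ℕ
count≥ j xs = countTrue (map (λ x → does (j ≤? x)) xs)

-- α* in the paper: the 2-modular conjugate of the partition with parts 2 · suffixSums es.
conjugate₂ : List ℕ → List ℕ
conjugate₂ [] = []
conjugate₂ (e ∷ es) = map (2 +_) (conjugate₂ es) ++ replicate e 2

upperParts-∸ : ∀ c es → map (λ x → x ∸ c) (upperParts c es) ≡ map (2 *_) (suffixSums es)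
upperParts-∸ c [] = refl
upperParts-∸ c (e ∷ es) = cong₂ _∷_ head-∸ (upperParts-∸ c es)
  where
  head-∸ : 2 * e + headOr c (upperParts c es) ∸ c ≡ 2 * (e + sum es)
  head-∸ rewrite headOr-upperParts c es | sym (+-assoc (2 * e) (2 * sum es) c) =
    trans (m+n∸n≡m (2 * e + 2 * sum es) c) (sym (*-distribˡ-+ 2 e (sum es)))

count≥-2* : ∀ j xs → countTrue (map (λ a → does (2 * j ≤? a)) (map (2 *_) xs)) ≡ count≥ j xs
count≥-2* j [] = refl
count≥-2* j (x ∷ xs) with j ≤? x
... | yes j≤x rewrite dec-true (2 * j ≤? 2 * x) (*-monoʳ-≤ 2 j≤x) | dec-true (j ≤? x) j≤x = cong suc (count≥-2* j xs)
... | no j≰x rewrite dec-false (2 * j ≤? 2 * x) (j≰x ∘ *-cancelˡ-≤ 2) | dec-false (j ≤? x) j≰x = count≥-2* j xs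

count≥-suffixSums-∷ : ∀ j e es → j ≤ e + sum es → count≥ j (suffixSums (e ∷ es)) ≡ suc (count≥ j (suffixSums es))
count≥-suffixSums-∷ j e es le rewrite dec-true (j ≤? e + sum es) le = refl

count≥-suffixSums-0 : ∀ j es → sum es < j → count≥ j (suffixSums es) ≡ 0
count≥-suffixSums-0 j [] _ = refl
count≥-suffixSums-0 j (e ∷ es) lt rewrite dec-false (j ≤? e + sum es) (<⇒≱ lt) =
  count≥-suffixSums-0 j es (≤-<-trans (m≤n+m (sum es) e) lt)

range1-+ : ∀ a b → range1 (a + b) ≡ range1 a ++ map (a +_) (range1 b)
range1-+ a zero = trans (cong range1 (+-identityʳ a)) (sym (++-identityʳ (range1 a)))
range1-+ a (suc b) = begin
  range1 (a + suc b)                                       ≡⟨ cong range1 (+-suc a b) ⟩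
  range1 (a + b) ++ suc (a + b) ∷ []                       ≡⟨ cong (_++ suc (a + b) ∷ []) (range1-+ a b) ⟩
  (range1 a ++ map (a +_) (range1 b)) ++ suc (a + b) ∷ []  ≡⟨ ++-assoc (range1 a) _ _ ⟩
  range1 a ++ map (a +_) (range1 b) ++ suc (a + b) ∷ []
    ≡⟨ cong (λ x → range1 a ++ map (a +_) (range1 b) ++ x ∷ []) (+-suc a b) ⟨
  range1 a ++ map (a +_) (range1 b) ++ a + suc b ∷ []      ≡⟨ cong (range1 a ++_) (map-++ (a +_) (range1 b) (suc b ∷ [])) ⟨
  range1 a ++ map (a +_) (range1 (suc b))                  ∎
  where open ≡-Reasoning

map-cong-range1 : ∀ n {f g : ℕ → ℕ} → (∀ j → 1 ≤ j → j ≤ n → f j ≡ g j) →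
  map f (range1 n) ≡ map g (range1 n)
map-cong-range1 zero _ = refl
map-cong-range1 (suc n) {f} {g} f≗g = begin
  map f (range1 n ++ suc n ∷ [])      ≡⟨ map-++ f (range1 n) (suc n ∷ []) ⟩
  map f (range1 n) ++ f (suc n) ∷ []  ≡⟨ cong₂ (λ xs x → xs ++ x ∷ []) below (f≗g (suc n) (s≤s z≤n) ≤-refl) ⟩
  map g (range1 n) ++ g (suc n) ∷ []  ≡⟨ map-++ g (range1 n) (suc n ∷ []) ⟨
  map g (range1 n ++ suc n ∷ [])      ∎
  where
  open ≡-Reasoning
  below = map-cong-range1 n (λ j 1≤j j≤n → f≗g j 1≤j (m≤n⇒m≤1+n j≤n))

map-const-range1 : ∀ n (x : ℕ) → map (λ _ → x) (range1 n) ≡ replicate n x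
map-const-range1 zero x = refl
map-const-range1 (suc n) x = begin
  map (λ _ → x) (range1 n ++ suc n ∷ [])  ≡⟨ map-++ (λ _ → x) (range1 n) (suc n ∷ []) ⟩
  map (λ _ → x) (range1 n) ++ x ∷ []      ≡⟨ cong (_++ x ∷ []) (map-const-range1 n x) ⟩
  replicate n x ++ x ∷ []                 ≡⟨ replicate-∷ʳ n x ⟩
  replicate (suc n) x                     ∎
  where open ≡-Reasoning

conjugate₂-suffixSums : ∀ es → map (λ j → 2 * count≥ j (suffixSums es)) (range1 (sum es)) ≡ conjugate₂ es
conjugate₂-suffixSums [] = refl
conjugate₂-suffixSums (e ∷ es) = begin
  map F (range1 (e + s))                              ≡⟨ cong (map F ∘ range1) (+-comm e s) ⟩
  map F (range1 (s + e))                              ≡⟨ cong (map F) (range1-+ s e) ⟩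
  map F (range1 s ++ map (s +_) (range1 e))           ≡⟨ map-++ F (range1 s) _ ⟩
  map F (range1 s) ++ map F (map (s +_) (range1 e))   ≡⟨ cong₂ _++_ below-s above-s ⟩
  map (2 +_) (conjugate₂ es) ++ replicate e 2         ∎
  where
  open ≡-Reasoning
  s = sum es
  F F′ : ℕ → ℕ
  F j = 2 * count≥ j (suffixSums (e ∷ es))
  F′ j = 2 * count≥ j (suffixSums es)
  below-s : map F (range1 s) ≡ map (2 +_) (conjugate₂ es)
  below-s = begin
    map F (range1 s)               ≡⟨ map-cong-range1 s (λ j _ j≤s → F≡2+F′ j (≤-trans j≤s (m≤n+m s e))) ⟩
    map ((2 +_) ∘ F′) (range1 s)   ≡⟨ map-∘ (range1 s) ⟩
    map (2 +_) (map F′ (range1 s)) ≡⟨ cong (map (2 +_)) (conjugate₂-suffixSums es) ⟩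
    map (2 +_) (conjugate₂ es)     ∎
    where
    F≡2+F′ : ∀ j → j ≤ e + s → F j ≡ 2 + F′ j
    F≡2+F′ j j≤ = trans (cong (2 *_) (count≥-suffixSums-∷ j e es j≤)) (*-suc 2 (count≥ j (suffixSums es)))
  above-s : map F (map (s +_) (range1 e)) ≡ replicate e 2
  above-s = begin
    map F (map (s +_) (range1 e))  ≡⟨ map-∘ (range1 e) ⟨
    map (F ∘ (s +_)) (range1 e)    ≡⟨ map-cong-range1 e F[s+j]≡2 ⟩
    map (λ _ → 2) (range1 e)       ≡⟨ map-const-range1 e 2 ⟩
    replicate e 2                  ∎
    where
    F[s+j]≡2 : ∀ j → 1 ≤ j → j ≤ e → F (s + j) ≡ 2
    F[s+j]≡2 j 1≤j j≤e = trans
      (cong (2 *_) (count≥-suffixSums-∷ (s + j) e es (subst (s + j ≤_) (+-comm s e) (+-monoʳ-≤ s j≤e))))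
      (cong (λ n → 2 * suc n) (count≥-suffixSums-0 (s + j) es (m<m+n s 1≤j)))

conjugate₂-positive : ∀ es → All (1 ≤_) (conjugate₂ es)
conjugate₂-positive [] = []
conjugate₂-positive (e ∷ es) =
  Allₚ.++⁺ (Allₚ.map⁺ (All.universal (λ _ → s≤s z≤n) (conjugate₂ es))) (Allₚ.replicate⁺ e (s≤s z≤n))

conjugate₂-range1 : ∀ es S → sum es ≤ S →
  filter (λ y → 1 ≤? y) (map (λ j → 2 * count≥ j (suffixSums es)) (range1 S)) ≡ conjugate₂ es
conjugate₂-range1 es S s≤S = begin
  filter P? (map F (range1 S))
    ≡⟨ cong (λ n → filter P? (map F (range1 n))) (m+[n∸m]≡n s≤S) ⟨
  filter P? (map F (range1 (s + t)))
    ≡⟨ cong (filter P? ∘ map F) (range1-+ s t) ⟩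
  filter P? (map F (range1 s ++ map (s +_) (range1 t)))
    ≡⟨ cong (filter P?) (map-++ F (range1 s) _) ⟩
  filter P? (map F (range1 s) ++ map F (map (s +_) (range1 t)))
    ≡⟨ filter-++ P? (map F (range1 s)) _ ⟩
  filter P? (map F (range1 s)) ++ filter P? (map F (map (s +_) (range1 t)))
    ≡⟨ cong₂ (λ xs ys → filter P? xs ++ filter P? ys) (conjugate₂-suffixSums es) zeros ⟩
  filter P? (conjugate₂ es) ++ filter P? (replicate t 0)
    ≡⟨ cong₂ _++_ (filter-all P? (conjugate₂-positive es)) (filter-none P? (Allₚ.replicate⁺ t λ ())) ⟩
  conjugate₂ es ++ []
    ≡⟨ ++-identityʳ (conjugate₂ es) ⟩
  conjugate₂ es ∎
  where
  open ≡-Reasoning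
  P? = λ y → 1 ≤? y
  s = sum es
  t = S ∸ s
  F : ℕ → ℕ
  F j = 2 * count≥ j (suffixSums es)
  zeros : map F (map (s +_) (range1 t)) ≡ replicate t 0
  zeros = begin
    map F (map (s +_) (range1 t))  ≡⟨ map-∘ (range1 t) ⟨
    map (F ∘ (s +_)) (range1 t)    ≡⟨ map-cong-range1 t (λ j 1≤j _ → cong (2 *_) (count≥-suffixSums-0 (s + j) es (m<m+n s 1≤j))) ⟩
    map (λ _ → 0) (range1 t)       ≡⟨ map-const-range1 t 0 ⟩
    replicate t 0                  ∎

sum-≤-upperParts : ∀ c es → sum es ≤ sum (upperParts c es)
sum-≤-upperParts c [] = z≤n
sum-≤-upperParts c (e ∷ es) =
  +-mono-≤ (≤-trans (m≤m+n e (e + 0)) (m≤m+n (2 * e) (headOr c (upperParts c es)))) (sum-≤-upperParts c es)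

-- `αStar` and `ηLast` restate the local definitions of `alt`.
αStar : ℕ → List ℕ → List ℕ
αStar d l = filter (λ y → 1 ≤? y)
  (map (λ j → 2 * countTrue (map (λ a → does (2 * j ≤? a)) (map (λ x → x ∸ (2 * d ∸ 1)) (take d l))))
       (range1 (sum l)))

ηLast : ℕ → List ℕ → ℕ
ηLast d l = if does (2 * d ∸ 1 <? part d l) then 2 * d else 2 * d ∸ 1

alt-≡ : ∀ l d → dur2 l ≡ suc d →
  alt l ≡ parityChanges 0 (sort (αStar (suc d) l ++ drop (suc d) l) ++ ηLast (suc d) l ∷ [])
alt-≡ l d eq with dur2 l
alt-≡ l d refl | .(suc d) = refl

αStar-oddSide : ∀ v → αStar ⌈ length v /2⌉ (oddSide v) ≡ conjugate₂ (evenEntries v)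
αStar-oddSide v = begin
  conj (map (λ x → x ∸ c) (take d (oddSide v)))    ≡⟨ cong (conj ∘ map (λ x → x ∸ c)) (take-oddSide v) ⟩
  conj (map (λ x → x ∸ c) (upperParts c es))       ≡⟨ cong conj (upperParts-∸ c es) ⟩
  conj (map (2 *_) (suffixSums es))                ≡⟨ cong (filter P?) (map-cong count≥-2*′ (range1 S)) ⟩
  filter P? (map (λ j → 2 * count≥ j (suffixSums es)) (range1 S)) ≡⟨ conjugate₂-range1 es S es≤S ⟩
  conjugate₂ es                                    ∎
  where
  open ≡-Reasoning
  P? = λ y → 1 ≤? y
  d = ⌈ length v /2⌉
  c = 2 * d ∸ 1
  es = evenEntries v
  S = sum (oddSide v)
  conj : List ℕ → List ℕ
  conj αs = filter P? (map (λ j → 2 * countTrue (map (λ a → does (2 * j ≤? a)) αs)) (range1 S))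
  count≥-2*′ : ∀ j → 2 * countTrue (map (λ a → does (2 * j ≤? a)) (map (2 *_) (suffixSums es))) ≡
                     2 * count≥ j (suffixSums es)
  count≥-2*′ j = cong (2 *_) (count≥-2* j (suffixSums es))
  es≤S : sum es ≤ S
  es≤S = ≤-trans (sum-≤-upperParts c es)
           (subst (sum (upperParts c es) ≤_) (sym (sum-++ (upperParts c es) _)) (m≤m+n _ _))

part-upperParts : ∀ c es ys → 1 ≤ length es → part (length es) (upperParts c es ++ ys) ≡ 2 * part (length es) es + c
part-upperParts c (e ∷ []) ys _ = refl
part-upperParts c (e ∷ e′ ∷ es) ys _ = part-upperParts c (e′ ∷ es) ys (s≤s z≤n)

evenEntries-last : ∀ x r → let d = ⌈ length (x ∷ r) /2⌉ in
  (part d (evenEntries (x ∷ r)) ≡ 0 × length (x ∷ r) ≡ 2 * d ∸ 1) ⊎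
  (∃[ e ] part d (evenEntries (x ∷ r)) ≡ suc e × length (x ∷ r) ≡ 2 * d)
evenEntries-last x [] = inj₁ (refl , refl)
evenEntries-last x (e ∷ []) = inj₂ (e , refl , refl)
evenEntries-last x (e ∷ y ∷ r) with evenEntries-last y r
... | inj₁ (last≡0 , len) = inj₁ (last≡0 , trans (cong (2 +_) len) (sym (2*suc[suc]∸1 ⌊ length r /2⌋)))
... | inj₂ (e′ , last≡ , len) = inj₂ (e′ , last≡ , trans (cong (2 +_) len) (sym (*-suc 2 (suc ⌊ length r /2⌋))))

ηLast-oddSide : ∀ x r → ηLast ⌈ length (x ∷ r) /2⌉ (oddSide (x ∷ r)) ≡ length (x ∷ r)
ηLast-oddSide x r = begin
  ηLast d (oddSide v)                           ≡⟨ cong (λ n → if does (c <? n) then 2 * d else c) last-part ⟩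
  (if does (c <? 2 * p + c) then 2 * d else c)   ≡⟨ by-parity (evenEntries-last x r) ⟩
  length v                                      ∎
  where
  open ≡-Reasoning
  v = x ∷ r
  d = ⌈ length v /2⌉
  c = 2 * d ∸ 1
  p = part d (evenEntries v)
  last-part : part d (oddSide v) ≡ 2 * p + c
  last-part = subst (λ n → part n (oddSide v) ≡ 2 * part n (evenEntries v) + c) (length-evenEntries v)
    (part-upperParts c (evenEntries v) _ (subst (1 ≤_) (sym (length-evenEntries v)) (s≤s z≤n)))
  by-parity : (p ≡ 0 × length v ≡ c) ⊎ (∃[ e ] p ≡ suc e × length v ≡ 2 * d) →
    (if does (c <? 2 * p + c) then 2 * d else c) ≡ length v
  by-parity (inj₁ (p≡0 , len)) = begin
    (if does (c <? 2 * p + c) then 2 * d else c)  ≡⟨ cong (λ n → if does (c <? 2 * n + c) then 2 * d else c) p≡0 ⟩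
    (if does (c <? c) then 2 * d else c)          ≡⟨ cong (if_then 2 * d else c) (dec-false (c <? c) (n≮n c)) ⟩
    c                                             ≡⟨ len ⟨
    length v                                      ∎
  by-parity (inj₂ (e , p≡ , len)) = begin
    (if does (c <? 2 * p + c) then 2 * d else c)        ≡⟨ cong (λ n → if does (c <? 2 * n + c) then 2 * d else c) p≡ ⟩
    (if does (c <? 2 * suc e + c) then 2 * d else c)    ≡⟨ cong (if_then 2 * d else c) (dec-true (c <? 2 * suc e + c) c<) ⟩
    2 * d                                               ≡⟨ len ⟨
    length v                                            ∎
    where
    c< : c < 2 * suc e + c
    c< = m<n+m c {2 * suc e} (s≤s z≤n)

-- The sorted sequence η = α* ∪ β of the paper, as a function of the gap vector.
η : List ℕ → List ℕ
η [] = []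
η (o ∷ []) = replicate o 1
η (o ∷ e ∷ []) = replicate o 1 ++ replicate (suc e) 2
η (o ∷ e ∷ x ∷ r) = replicate o 1 ++ replicate e 2 ++ map (2 +_) (η (x ∷ r))

η-↭ : ∀ v → conjugate₂ (evenEntries v) ++ lowerParts (oddEntries v) ↭ η v
η-↭ [] = ↭-refl
η-↭ (o ∷ []) = ↭-refl
η-↭ (o ∷ e ∷ []) = Permₚ.++-comm (replicate (suc e) 2) (replicate o 1)
η-↭ (o ∷ e ∷ x ∷ r) = begin
  (map (2 +_) C ++ replicate e 2) ++ (map (2 +_) L ++ replicate o 1)
    ↭⟨ ↭-solve 4 (λ C E L O → (C ⊕ E) ⊕ (L ⊕ O) ⊜ O ⊕ (E ⊕ (C ⊕ L))) ↭-refl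
                 (map (2 +_) C) (replicate e 2) (map (2 +_) L) (replicate o 1) ⟩
  replicate o 1 ++ replicate e 2 ++ map (2 +_) C ++ map (2 +_) L
    ≡⟨ cong (λ xs → replicate o 1 ++ replicate e 2 ++ xs) (map-++ (2 +_) C L) ⟨
  replicate o 1 ++ replicate e 2 ++ map (2 +_) (C ++ L)
    ↭⟨ Permₚ.++⁺ˡ (replicate o 1) (Permₚ.++⁺ˡ (replicate e 2) (Permₚ.map⁺ (2 +_) (η-↭ (x ∷ r)))) ⟩
  replicate o 1 ++ replicate e 2 ++ map (2 +_) (η (x ∷ r)) ∎
  where
  open PermutationReasoning
  C = conjugate₂ (evenEntries (x ∷ r))
  L = lowerParts (oddEntries (x ∷ r))

η-ascends : ∀ v → Linked _≤_ (0 ∷ η v)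
η-ascends [] = [-]
η-ascends (o ∷ []) =
  subst (λ xs → Linked _≤_ (0 ∷ xs)) (++-identityʳ (replicate o 1)) (ascends-replicate o z≤n [-])
η-ascends (o ∷ e ∷ []) = ascends-replicate o z≤n
  (subst (λ xs → Linked _≤_ (1 ∷ xs)) (++-identityʳ (replicate (suc e) 2)) (ascends-replicate (suc e) (s≤s z≤n) [-]))
η-ascends (o ∷ e ∷ x ∷ r) = ascends-replicate o z≤n (ascends-replicate e (s≤s z≤n)
  (Linkedₚ.map⁺ (Linked.map (λ le → s≤s (s≤s le)) (η-ascends (x ∷ r)))))

sort-oddSide : ∀ v → sort (conjugate₂ (evenEntries v) ++ lowerParts (oddEntries v)) ≡ η v
sort-oddSide v = sort-unique (η-↭ v) (Linked.tail (η-ascends v))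

η-withMultiplicities : ∀ v → η v ≡ withMultiplicities 1 v ⊎ η v ≡ withMultiplicities 1 v ++ length v ∷ []
η-withMultiplicities [] = inj₁ refl
η-withMultiplicities (o ∷ []) = inj₁ (sym (++-identityʳ (replicate o 1)))
η-withMultiplicities (o ∷ e ∷ []) = inj₂ (begin
  replicate o 1 ++ replicate (suc e) 2             ≡⟨ cong (replicate o 1 ++_) (replicate-∷ʳ e 2) ⟨
  replicate o 1 ++ replicate e 2 ++ 2 ∷ []         ≡⟨ cong (λ xs → replicate o 1 ++ xs ++ 2 ∷ []) (++-identityʳ (replicate e 2)) ⟨
  replicate o 1 ++ (replicate e 2 ++ []) ++ 2 ∷ [] ≡⟨ ++-assoc (replicate o 1) (replicate e 2 ++ []) (2 ∷ []) ⟨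
  (replicate o 1 ++ replicate e 2 ++ []) ++ 2 ∷ [] ∎)
  where open ≡-Reasoning
η-withMultiplicities (o ∷ e ∷ x ∷ r) with η-withMultiplicities (x ∷ r)
... | inj₁ eq = inj₁ (cong (λ xs → replicate o 1 ++ replicate e 2 ++ xs)
                        (trans (cong (map (2 +_)) eq) (map-withMultiplicities 1 (x ∷ r))))
... | inj₂ eq = inj₂ (begin
  pre (map (2 +_) (η w))                        ≡⟨ cong (pre ∘ map (2 +_)) eq ⟩
  pre (map (2 +_) (W ++ k′ ∷ []))               ≡⟨ cong pre (map-++ (2 +_) W (k′ ∷ [])) ⟩
  pre (map (2 +_) W ++ 2 + k′ ∷ [])             ≡⟨ cong (λ xs → pre (xs ++ 2 + k′ ∷ [])) (map-withMultiplicities 1 w) ⟩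
  pre (withMultiplicities 3 w ++ 2 + k′ ∷ [])   ≡⟨ pre-++ (withMultiplicities 3 w) (2 + k′ ∷ []) ⟩
  pre (withMultiplicities 3 w) ++ 2 + k′ ∷ []   ∎)
  where
  open ≡-Reasoning
  w = x ∷ r
  W = withMultiplicities 1 w
  k′ = length w
  pre : List ℕ → List ℕ
  pre xs = replicate o 1 ++ replicate e 2 ++ xs
  pre-++ : ∀ ys zs → pre (ys ++ zs) ≡ pre ys ++ zs
  pre-++ ys zs = sym (trans (++-assoc (replicate o 1) (replicate e 2 ++ ys) zs)
                            (cong (replicate o 1 ++_) (++-assoc (replicate e 2) ys zs)))

parityChanges-η : ∀ p v →
  parityChanges p (η v ++ length v ∷ []) ≡ parityChanges p (withMultiplicities 1 v ++ length v ∷ [])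
parityChanges-η p v with η-withMultiplicities v
... | inj₁ eq = cong (λ xs → parityChanges p (xs ++ length v ∷ [])) eq
... | inj₂ eq = begin
  parityChanges p (η v ++ k ∷ [])                           ≡⟨ cong (λ xs → parityChanges p (xs ++ k ∷ [])) eq ⟩
  parityChanges p ((W ++ k ∷ []) ++ k ∷ [])                 ≡⟨ cong (parityChanges p) (++-assoc W (k ∷ []) (k ∷ [])) ⟩
  parityChanges p (W ++ k ∷ k ∷ [])                         ≡⟨ parityChanges-++ p W k (k ∷ []) ⟩
  parityChanges p (W ++ k ∷ []) + parityChanges k (k ∷ [])  ≡⟨ cong (parityChanges p (W ++ k ∷ []) +_) no-change ⟩
  parityChanges p (W ++ k ∷ []) + 0                         ≡⟨ +-identityʳ _ ⟩
  parityChanges p (W ++ k ∷ [])                             ∎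
  where
  open ≡-Reasoning
  k = length v
  W = withMultiplicities 1 v
  no-change : parityChanges k (k ∷ []) ≡ 0
  no-change = trans (parityChanges-single k k) (cong bit (xor-same (isOdd k)))

alt-oddSide : ∀ v → alt (oddSide v) ≡ oddSequences (fromGaps v)
alt-oddSide [] = refl
alt-oddSide v@(x ∷ r) = begin
  alt (oddSide v)
    ≡⟨ alt-≡ (oddSide v) ⌊ length r /2⌋ (dur2-oddSide v) ⟩
  parityChanges 0 (sort (αStar d (oddSide v) ++ drop d (oddSide v)) ++ ηLast d (oddSide v) ∷ [])
    ≡⟨ cong₂ (λ xs y → parityChanges 0 (sort xs ++ y ∷ []))
             (cong₂ _++_ (αStar-oddSide v) (drop-oddSide v)) (ηLast-oddSide x r) ⟩
  parityChanges 0 (sort (conjugate₂ (evenEntries v) ++ lowerParts (oddEntries v)) ++ length v ∷ [])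
    ≡⟨ cong (λ xs → parityChanges 0 (xs ++ length v ∷ [])) (sort-oddSide v) ⟩
  parityChanges 0 (η v ++ length v ∷ [])
    ≡⟨ parityChanges-η 0 v ⟩
  parityChanges 0 (withMultiplicities 1 v ++ length v ∷ [])
    ≡⟨ parityChanges-withMultiplicities x r 0 1 1 refl ⟩
  countOdd (gapRuns 1 x r)
    ≡⟨ oddSequences-fromGaps x r ⟨
  oddSequences (fromGaps v) ∎
  where
  open ≡-Reasoning
  d = ⌈ length v /2⌉

-- The bijection

oddPartitionWith : ℕ → ℕ → ℕ → List ℕ → Bool
oddPartitionWith n d m l = isOddPartition n l ∧ (dur2 l ≡ᵇ d) ∧ (alt l ≡ᵇ m)

distinctPartitionWith : ℕ → ℕ → ℕ → List ℕ → Bool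
distinctPartitionWith n k m l = isDistinctPartition n k l ∧ (oddSequences l ≡ᵇ m)

oddPartitionWith⁻ : ∀ {n d m} l → T (oddPartitionWith n d m l) →
  Linked _≥_ l × All Odd l × sum l ≡ n × dur2 l ≡ d × alt l ≡ m
oddPartitionWith⁻ l t with T-∧⁻ t
... | op , rest with T-∧⁻ op | T-∧⁻ rest
... | ni , ao∧sum | dur , alt≡ with T-∧⁻ ao∧sum
... | ao , sum≡ = nonIncr⇒Linked l ni , allOdd⇒All l ao , ≡ᵇ⇒≡ _ _ sum≡ , ≡ᵇ⇒≡ _ _ dur , ≡ᵇ⇒≡ _ _ alt≡

oddPartitionWith⁺ : ∀ {n d m} l → Linked _≥_ l → All Odd l → sum l ≡ n → dur2 l ≡ d → alt l ≡ m →
  T (oddPartitionWith n d m l)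
oddPartitionWith⁺ l l↓ ol sum≡ dur alt≡ =
  T-∧⁺ (T-∧⁺ (Linked⇒nonIncr l↓) (T-∧⁺ (All⇒allOdd ol) (≡⇒≡ᵇ _ _ sum≡))) (T-∧⁺ (≡⇒≡ᵇ _ _ dur) (≡⇒≡ᵇ _ _ alt≡))

distinctPartitionWith⁻ : ∀ {n k m} l → T (distinctPartitionWith n k m l) →
  T (strictDec l) × sum l ≡ n × length l ≡ k × oddSequences l ≡ m
distinctPartitionWith⁻ l t with T-∧⁻ t
... | dp , os≡ with T-∧⁻ dp
... | sd , sum∧len with T-∧⁻ sum∧len
... | sum≡ , len≡ = sd , ≡ᵇ⇒≡ _ _ sum≡ , ≡ᵇ⇒≡ _ _ len≡ , ≡ᵇ⇒≡ _ _ os≡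

distinctPartitionWith⁺ : ∀ {n k m} l → T (strictDec l) → sum l ≡ n → length l ≡ k → oddSequences l ≡ m →
  T (distinctPartitionWith n k m l)
distinctPartitionWith⁺ l sd sum≡ len≡ os≡ = T-∧⁺ (T-∧⁺ sd (T-∧⁺ (≡⇒≡ᵇ _ _ sum≡) (≡⇒≡ᵇ _ _ len≡))) (≡⇒≡ᵇ _ _ os≡)

IsGapVector : ℕ → ℕ → ℕ → List ℕ → Set
IsGapVector n k m v = sum (fromGaps v) ≡ n × length v ≡ k × oddSequences (fromGaps v) ≡ m

gapVector⇒distinct : ∀ {n k m} v → IsGapVector n k m v → T (distinctPartitionWith n k m (fromGaps v))
gapVector⇒distinct v (sum≡ , len≡ , os≡) =
  distinctPartitionWith⁺ (fromGaps v) (strictDec-fromGaps v) sum≡ (trans (length-fromGaps v) len≡) os≡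

distinct⇒gapVector : ∀ {n k m} l → T (distinctPartitionWith n k m l) →
  IsGapVector n k m (toGaps l) × fromGaps (toGaps l) ≡ l
distinct⇒gapVector l t with distinctPartitionWith⁻ l t
... | sd , sum≡ , len≡ , os≡ with fromGaps-toGaps l sd
... | inverse = (trans (cong sum inverse) sum≡ ,
                 trans (sym (length-fromGaps (toGaps l))) (trans (cong length inverse) len≡) ,
                 trans (cong oddSequences inverse) os≡) , inverse

gapVector⇒odd : ∀ {n k m} v → IsGapVector n k m v → T (oddPartitionWith n ⌈ k /2⌉ m (oddSide v))
gapVector⇒odd v (sum≡ , len≡ , os≡) = oddPartitionWith⁺ (oddSide v) (oddSide-descends v) (oddSide-odd v)
  (trans (sum-oddSide v) sum≡) (trans (dur2-oddSide v) (cong ⌈_/2⌉ len≡)) (trans (alt-oddSide v) os≡)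

odd⇒gapVector : ∀ {n k m} l → 1 ≤ k → m % 2 ≡ k % 2 → T (oddPartitionWith n ⌈ k /2⌉ m l) →
  IsGapVector n k m (oddSide⁻¹ ⌈ k /2⌉ l) × oddSide (oddSide⁻¹ ⌈ k /2⌉ l) ≡ l
odd⇒gapVector {n} {suc k} {m} l _ m≡k t with oddPartitionWith⁻ l t
... | l↓ , ol , sum≡ , dur , alt≡ with oddSide-oddSide⁻¹ l ⌊ k /2⌋ l↓ ol dur
... | inverse = (sum≡′ , len≡ , os≡) , inverse
  where
  v = oddSide⁻¹ ⌈ suc k /2⌉ l
  sum≡′ : sum (fromGaps v) ≡ n
  sum≡′ = trans (sym (sum-oddSide v)) (trans (cong sum inverse) sum≡)
  os≡ : oddSequences (fromGaps v) ≡ m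
  os≡ = trans (sym (alt-oddSide v)) (trans (cong alt inverse) alt≡)
  len≡ : length v ≡ suc k
  len≡ = ⌈/2⌉-parity-injective (length v) (suc k)
    (trans (sym (dur2-oddSide v)) (trans (cong dur2 inverse) dur))
    (trans (sym (oddSequences-parity v)) (trans (cong isOdd os≡) (cong (_≡ᵇ 1) m≡k)))

subset-↔ : ∀ {A B : Set} {P : A → Bool} {Q : B → Bool} (f : A → B) (g : B → A) →
  (∀ a → T (P a) → T (Q (f a))) → (∀ b → T (Q b) → T (P (g b))) →
  (∀ a → T (P a) → g (f a) ≡ a) → (∀ b → T (Q b) → f (g b) ≡ b) →
  Σ A (λ a → T (P a)) ↔ Σ B (λ b → T (Q b))
subset-↔ {P = P} {Q} f g PQ QP gf fg = mk↔ₛ′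
  (λ (a , p) → f a , PQ a p) (λ (b , q) → g b , QP b q)
  (λ (b , q) → Σ-≡ (fg b q)) (λ (a , p) → Σ-≡ (gf a p))
  where
  Σ-≡ : ∀ {C : Set} {R : C → Bool} {x y : C} {r : T (R x)} {s : T (R y)} → x ≡ y → (x , r) ≡ (y , s)
  Σ-≡ {r = r} {s} refl = cong (_ ,_) (T-irrelevant r s)

theorem1p3 : (n k m : ℕ) → 1 ≤ n → 1 ≤ k → m % 2 ≡ k % 2 →
    (Σ (List ℕ) (λ l → T (isOddPartition n l ∧ (dur2 l ≡ᵇ ⌈ k /2⌉) ∧ (alt l ≡ᵇ m))))
      ↔ (Σ (List ℕ) (λ l → T (isDistinctPartition n k l ∧ (oddSequences l ≡ᵇ m))))
theorem1p3 n k m _ 1≤k m≡k = subset-↔ (fromGaps ∘ oddSide⁻¹ d) (oddSide ∘ toGaps)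
  (λ l p → gapVector⇒distinct (oddSide⁻¹ d l) (proj₁ (odd⇒gapVector l 1≤k m≡k p)))
  (λ l q → gapVector⇒odd (toGaps l) (proj₁ (distinct⇒gapVector l q)))
  (λ l p → trans (cong oddSide (toGaps-fromGaps (oddSide⁻¹ d l))) (proj₂ (odd⇒gapVector l 1≤k m≡k p)))
  fromGaps-oddSide⁻¹
  where
  open ≡-Reasoning
  d = ⌈ k /2⌉
  fromGaps-oddSide⁻¹ : ∀ l → T (distinctPartitionWith n k m l) → fromGaps (oddSide⁻¹ d (oddSide (toGaps l))) ≡ l
  fromGaps-oddSide⁻¹ l q with distinct⇒gapVector l q
  ... | (_ , |w|≡k , _) , inverse = begin
    fromGaps (oddSide⁻¹ ⌈ k /2⌉ (oddSide (toGaps l)))               ≡⟨ cong (λ n → fromGaps (oddSide⁻¹ ⌈ n /2⌉ _)) |w|≡k ⟨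
    fromGaps (oddSide⁻¹ ⌈ length (toGaps l) /2⌉ (oddSide (toGaps l))) ≡⟨ cong fromGaps (oddSide⁻¹-oddSide (toGaps l)) ⟩
    fromGaps (toGaps l)                                            ≡⟨ inverse ⟩
    l                                                              ∎
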